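{- Let $n\ge1$ and $1\le p\le n$. A configuration $C\in\mathcal{S}(n,p)$ is $p$-toppleable if and only if for every $1\le i\le n+1$, $$p+i-n-1\le C^{ -1}(i)\le p+i-1,$$ where $C^{ -1}(i)$ denotes the site of chip $i$ in $C$.
   Context: Sites $L_n=\{0,1,\dots,n+1\}$. $\mathcal{S}(n,p)$ is the set of configurations of chips $1,\dots,n+1$ with exactly one chip on each of sites $1,\dots,n$ and one additional chip on site $p$ (both chips on site $p$ have position $p$). Toppling: while some site $i$ has at least two chips, pick two chips $\alpha<\beta$ there and move $\alpha$ to $i-1$ and $\beta$ to $i+1$. The final configuration is independent of the choices and has one chip on every site but one. $C$ is $p$-toppleable if the chips in the final configuration, read left to right, are $1,2,\dots,n+1$ in order. -}

module Defs where

open import Data.Nat using (ℕ; suc)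
open import Data.Integer using (ℤ; +_; _+_; _-_; _<_; _≤_)
open import Data.Fin using (Fin; toℕ) renaming (_<_ to _<ᶠ_)
open import Data.List using (List; _∷_; map; upTo; allFin)
open import Data.List.Relation.Binary.Permutation.Propositional using (_↭_)
open import Data.Product using (Σ; ∃; _×_)
open import Relation.Binary.PropositionalEquality using (_≡_; _≢_)
open import Relation.Binary.Construct.Closure.ReflexiveTransitive using (Star)

-- A configuration of the n+1 chips 1,…,n+1 (chip k is represented by
-- c : Fin (suc n) with k = toℕ c + 1): the site (an integer) of each chip.
Config : ℕ → Set
Config n = Fin (suc n) → ℤ

sites : ∀ {n} → Config n → List ℤ
sites {n} C = map C (allFin (suc n))

-- C ∈ 𝒮(n,p): one chip on each of the sites 1,…,n and one extra chip on p,
-- i.e. the multiset of sites is {p} ⊎ {1,…,n}.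
InS : (n p : ℕ) → Config n → Set
InS n p C = sites C ↭ (+ p ∷ map (λ k → + suc k) (upTo n))

Topple : ∀ {n} → Config n → Config n → Set
Topple {n} C C′ =
  Σ (Fin (suc n)) λ α → Σ (Fin (suc n)) λ β →
    α <ᶠ β × C α ≡ C β ×
    C′ α ≡ C α - + 1 × C′ β ≡ C β + + 1 ×
    (∀ γ → γ ≢ α → γ ≢ β → C′ γ ≡ C γ)

Stable : ∀ {n} → Config n → Set
Stable {n} C = ∀ (α β : Fin (suc n)) → α ≢ β → C α ≢ C β

InOrder : ∀ {n} → Config n → Set
InOrder {n} C = ∀ (α β : Fin (suc n)) → α <ᶠ β → C α < C β

Toppleable : ∀ {n} → Config n → Set
Toppleable C = ∃ λ C′ → Star Topple C C′ × Stable C′ × InOrder C′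

module Submission where

-- On the configurations that occur (at most two chips per site, and an
-- empty site between any two doubled sites) two different topplings move
-- disjoint pairs of chips and commute, so all toppling sequences end in the
-- same configuration.  One of them runs in passes a = p, p − 1, …, 1: pass a
-- topples the sites a, a + 1, …, a + m (m = n − p) in turn, each time leaving
-- the smaller chip behind and carrying the larger one on, like a bubble-sort
-- sweep over a window that moves one site left per pass.  It ends with the
-- sites 0, …, m and m + 2, …, n + 1 occupied, so the chips are in order exactly
-- when the chip with label ℓ (counting from 0) sits on ℓ or ℓ + 1.  Before pass
-- a, "every chip right of the window is in place, and a chip ℓ on a site x of
-- the window has x − a ≤ ℓ ≤ x + m" is preserved by the pass in both
-- directions; for a = p these are the bounds of the theorem, for a = 0 they say
-- that the final configuration is in order.

module Confluence where

  open import Defs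
  open import Data.Nat as ℕ using (ℕ; suc)
  import Data.Nat.Properties as ℕP
  open import Data.Integer as ℤ using (ℤ; +_; -[1+_]; _+_; _-_; _<_; pred)
  import Data.Integer.Properties as ℤP
  open import Data.Fin using (Fin; _≟_) renaming (_<_ to _<ᶠ_)
  import Data.Fin.Properties as FinP
  open import Data.Product using (∃; ∃₂; _×_; _,_; proj₂)
  open import Data.Sum using (_⊎_; inj₁; inj₂)
  open import Data.Empty using (⊥; ⊥-elim)
  open import Relation.Nullary using (¬_; yes; no)
  open import Relation.Binary using (tri<; tri≈; tri>)
  open import Relation.Binary.PropositionalEquality
  open import Relation.Binary.Construct.Closure.ReflexiveTransitive using (Star; ε; _◅_)

  pred<self : ∀ s → pred s < s
  pred<self s = ℤP.i≤pred[j]⇒i<j ℤP.≤-refl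

  self<suc : ∀ s → s < ℤ.suc s
  self<suc s = ℤP.suc[i]≤j⇒i<j ℤP.≤-refl

  nothing-between-self-and-suc : ∀ {s z} → s < z → z < ℤ.suc s → ⊥
  nothing-between-self-and-suc s<z z<s+1 =
    ℤP.<-irrefl refl (ℤP.≤-<-trans (ℤP.i<j⇒suc[i]≤j s<z) z<s+1)

  nothing-between-pred-and-self : ∀ {s z} → pred s < z → z < s → ⊥
  nothing-between-pred-and-self {s} {z} p<z z<s =
    nothing-between-self-and-suc p<z (subst (z <_) (sym (ℤP.suc-pred s)) z<s)

  pred≢suc : ∀ s → pred s ≢ ℤ.suc s
  pred≢suc s e = ℤP.<-irrefl e (ℤP.<-trans (pred<self s) (self<suc s))

  Chip : ℕ → Set
  Chip n = Fin (suc n)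

  infix 4 _≈_
  _≈_ : ∀ {n} → Config n → Config n → Set
  C ≈ D = ∀ γ → C γ ≡ D γ

  ≈-sym : ∀ {n} {C D : Config n} → C ≈ D → D ≈ C
  ≈-sym C≈D γ = sym (C≈D γ)

  ≈-trans : ∀ {n} {C D E : Config n} → C ≈ D → D ≈ E → C ≈ E
  ≈-trans C≈D D≈E γ = trans (C≈D γ) (D≈E γ)

  module _ {n : ℕ} where

    shift : (α β γ : Chip n) → ℤ
    shift α β γ with γ ≟ α | γ ≟ β
    ... | yes _ | _     = -[1+ 0 ]
    ... | no _  | yes _ = + 1
    ... | no _  | no _  = + 0

    topple : Config n → Chip n → Chip n → Config n
    topple C α β γ = C γ + shift α β γ

    topple-small : ∀ C α β → topple C α β α ≡ C α - + 1
    topple-small C α β with α ≟ α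
    ... | yes _   = refl
    ... | no α≢α = ⊥-elim (α≢α refl)

    topple-large : ∀ C {α β} → α ≢ β → topple C α β β ≡ C β + + 1
    topple-large C {α} {β} α≢β with β ≟ α | β ≟ β
    ... | yes β≡α | _      = ⊥-elim (α≢β (sym β≡α))
    ... | no _    | yes _  = refl
    ... | no _    | no β≢β = ⊥-elim (β≢β refl)

    topple-other : ∀ C {α β γ} → γ ≢ α → γ ≢ β → topple C α β γ ≡ C γ
    topple-other C {α} {β} {γ} γ≢α γ≢β with γ ≟ α | γ ≟ β
    ... | yes γ≡α | _       = ⊥-elim (γ≢α γ≡α)
    ... | no _    | yes γ≡β = ⊥-elim (γ≢β γ≡β)
    ... | no _    | no _    = ℤP.+-identityʳ (C γ)

    topple-comm : ∀ C α β α′ β′ → topple (topple C α β) α′ β′ ≈ topple (topple C α′ β′) α β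
    topple-comm C α β α′ β′ γ = begin
      C γ + shift α β γ + shift α′ β′ γ   ≡⟨ ℤP.+-assoc (C γ) _ _ ⟩
      C γ + (shift α β γ + shift α′ β′ γ) ≡⟨ cong (λ w → C γ + w) (ℤP.+-comm (shift α β γ) _) ⟩
      C γ + (shift α′ β′ γ + shift α β γ) ≡⟨ ℤP.+-assoc (C γ) _ _ ⟨
      C γ + shift α′ β′ γ + shift α β γ   ∎
      where open ≡-Reasoning

    topple-Topple : ∀ {C : Config n} {α β} → α <ᶠ β → C α ≡ C β → Topple C (topple C α β)
    topple-Topple {C} {α} {β} α<β same =
      α , β , α<β , same , topple-small C α β , topple-large C (FinP.<⇒≢ α<β) ,
      λ γ → topple-other C

    Topple⇒topple : ∀ {C D : Config n} → Topple C D →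
                    ∃₂ λ α β → α <ᶠ β × C α ≡ C β × D ≈ topple C α β
    Topple⇒topple {C} {D} (α , β , α<β , same , Dα , Dβ , Dγ) = α , β , α<β , same , D≈
      where
        D≈ : D ≈ topple C α β
        D≈ γ with γ ≟ α | γ ≟ β
        ... | yes refl | _        = Dα
        ... | no _     | yes refl = Dβ
        ... | no γ≢α   | no γ≢β   = trans (Dγ γ γ≢α γ≢β) (sym (ℤP.+-identityʳ (C γ)))

    Topple-resp : ∀ {C C′ D D′ : Config n} → C ≈ C′ → D ≈ D′ → Topple C D → Topple C′ D′
    Topple-resp C≈ D≈ (α , β , α<β , same , Dα , Dβ , Dγ) =
      α , β , α<β , trans (sym (C≈ α)) (trans same (C≈ β)) ,
      trans (sym (D≈ α)) (trans Dα (cong (_- + 1) (C≈ α))) ,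
      trans (sym (D≈ β)) (trans Dβ (cong (_+ + 1) (C≈ β))) ,
      λ γ γ≢α γ≢β → trans (sym (D≈ γ)) (trans (Dγ γ γ≢α γ≢β) (C≈ γ))

    Stable-resp : ∀ {C D : Config n} → C ≈ D → Stable C → Stable D
    Stable-resp C≈D stable α β α≢β e = stable α β α≢β (trans (C≈D α) (trans e (sym (C≈D β))))

    InOrder-resp : ∀ {C D : Config n} → C ≈ D → InOrder C → InOrder D
    InOrder-resp C≈D in-order α β α<β = subst₂ _<_ (C≈D α) (C≈D β) (in-order α β α<β)

    Stable⇒¬Topple : ∀ {C D : Config n} → Stable C → ¬ Topple C D
    Stable⇒¬Topple stable (α , β , α<β , same , _) = stable α β (FinP.<⇒≢ α<β) same

    Vacant : Config n → ℤ → Set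
    Vacant C z = ∀ γ → C γ ≢ z

    Doubled : Config n → ℤ → Set
    Doubled C t = ∃₂ λ x y → x ≢ y × C x ≡ t × C y ≡ t

    -- Every configuration reachable from 𝒮(n,p) is tame; on tame configurations
    -- two topplings at one site are the same toppling.
    record Tame (C : Config n) : Set where
      field
        at-most-two : ∀ {a b c t} → a ≢ b → b ≢ c → a ≢ c →
                      C a ≡ t → C b ≡ t → C c ≡ t → ⊥
        vacancy-between : ∀ {t u} → Doubled C t → Doubled C u → t < u →
                          ∃ λ z → t < z × z < u × Vacant C z

    Tame-resp : ∀ {C D : Config n} → C ≈ D → Tame C → Tame D
    Tame-resp {C} {D} C≈D tame = record
      { at-most-two = λ a≢b b≢c a≢c Da Db Dc →
          at-most-two a≢b b≢c a≢c (back Da) (back Db) (back Dc)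
      ; vacancy-between = λ dt du t<u →
          let z , t<z , z<u , vacant = vacancy-between (doubled dt) (doubled du) t<u
          in z , t<z , z<u , λ γ e → vacant γ (back e)
      }
      where
        open Tame tame
        back : ∀ {γ t} → D γ ≡ t → C γ ≡ t
        back {γ} e = trans (C≈D γ) e
        doubled : ∀ {t} → Doubled D t → Doubled C t
        doubled (x , y , x≢y , Dx , Dy) = x , y , x≢y , back Dx , back Dy

    module Toppled {C : Config n} (tame : Tame C) {α β : Chip n}
                   (α≢β : α ≢ β) (same-site : C α ≡ C β) where
      open Tame tame

      s : ℤ
      s = C α

      D : Config n
      D = topple C α β

      data Role (γ : Chip n) : Set where
        small : γ ≡ α → Role γ
        large : γ ≡ β → Role γ
        other : γ ≢ α → γ ≢ β → Role γ

      role : ∀ γ → Role γ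
      role γ with γ ≟ α | γ ≟ β
      ... | yes γ≡α | _       = small γ≡α
      ... | no _    | yes γ≡β = large γ≡β
      ... | no γ≢α  | no γ≢β  = other γ≢α γ≢β

      IsOther : Chip n → Set
      IsOther γ = γ ≢ α × γ ≢ β

      D-small : D α ≡ pred s
      D-small = trans (topple-small C α β) (ℤP.+-comm s -[1+ 0 ])

      D-large : D β ≡ ℤ.suc s
      D-large = trans (topple-large C α≢β) (trans (ℤP.+-comm (C β) (+ 1)) (cong ℤ.suc (sym same-site)))

      D-other : ∀ {γ} → IsOther γ → D γ ≡ C γ
      D-other (γ≢α , γ≢β) = topple-other C γ≢α γ≢β

      movers-apart : D α ≢ D β
      movers-apart e = pred≢suc s (trans (sym D-small) (trans e D-large))

      sharer-of-mover : ∀ {x y} → x ≢ y → D x ≡ D y → ¬ IsOther x → IsOther y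
      sharer-of-mover {x} {y} x≢y Dx≡Dy x-moves with role x | role y
      ... | _         | other y≢α y≢β = y≢α , y≢β
      ... | small refl | small refl = ⊥-elim (x≢y refl)
      ... | large refl | large refl = ⊥-elim (x≢y refl)
      ... | small refl | large refl = ⊥-elim (movers-apart Dx≡Dy)
      ... | large refl | small refl = ⊥-elim (movers-apart (sym Dx≡Dy))
      ... | other x≢α x≢β | _ = ⊥-elim (x-moves (x≢α , x≢β))

      vacated : Vacant D s
      vacated γ Dγ≡s with role γ
      ... | small refl = ℤP.<⇒≢ (pred<self s) (trans (sym D-small) Dγ≡s)
      ... | large refl = ℤP.<⇒≢ (self<suc s) (sym (trans (sym D-large) Dγ≡s))
      ... | other γ≢α γ≢β =
        at-most-two α≢β (λ e → γ≢β (sym e)) (λ e → γ≢α (sym e)) refl (sym same-site)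
                    (trans (sym (D-other (γ≢α , γ≢β))) Dγ≡s)

      still-vacant : ∀ {z} → Vacant C z → z ≢ pred s → z ≢ ℤ.suc s → Vacant D z
      still-vacant vacant z≢pred z≢suc γ Dγ≡z with role γ
      ... | small refl = z≢pred (trans (sym Dγ≡z) D-small)
      ... | large refl = z≢suc (trans (sym Dγ≡z) D-large)
      ... | other γ≢α γ≢β = vacant γ (trans (sym (D-other (γ≢α , γ≢β))) Dγ≡z)

      doubled-at-s : Doubled C s
      doubled-at-s = α , β , α≢β , refl , sym same-site

      others-apart : ∀ {x y t} → x ≢ y → IsOther x → IsOther y → D x ≡ t → D y ≡ t →
                     t ≢ pred s × t ≢ s × t ≢ ℤ.suc s
      others-apart {x} {y} {t} x≢y ox@(x≢α , x≢β) oy Dx Dy = below , at , above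
        where
          doubled-at-t : Doubled C t
          doubled-at-t = x , y , x≢y , trans (sym (D-other ox)) Dx , trans (sym (D-other oy)) Dy
          below : t ≢ pred s
          below refl =
            let _ , t<z , z<s , _ = vacancy-between doubled-at-t doubled-at-s (pred<self s)
            in nothing-between-pred-and-self t<z z<s
          at : t ≢ s
          at refl = at-most-two α≢β (λ e → x≢β (sym e)) (λ e → x≢α (sym e))
                                refl (sym same-site) (trans (sym (D-other ox)) Dx)
          above : t ≢ ℤ.suc s
          above refl =
            let _ , s<z , z<t , _ = vacancy-between doubled-at-s doubled-at-t (self<suc s)
            in nothing-between-self-and-suc s<z z<t

      away-from-movers : ∀ {γ t} → D γ ≡ t → t ≢ pred s → t ≢ ℤ.suc s → IsOther γ
      away-from-movers {γ} Dγ t≢pred t≢suc with role γ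
      ... | small refl = ⊥-elim (t≢pred (trans (sym Dγ) D-small))
      ... | large refl = ⊥-elim (t≢suc (trans (sym Dγ) D-large))
      ... | other γ≢α γ≢β = γ≢α , γ≢β

      two-others : ∀ {a b c} → a ≢ b → b ≢ c → a ≢ c → D a ≡ D b → D b ≡ D c →
                   ∃₂ λ x y → x ≢ y × IsOther x × IsOther y × D x ≡ D a × D y ≡ D a
      two-others {a} {b} {c} a≢b b≢c a≢c Da≡Db Db≡Dc with role a | role b
      ... | other a≢α a≢β | other b≢α b≢β = a , b , a≢b , (a≢α , a≢β) , (b≢α , b≢β) , refl , sym Da≡Db
      ... | other a≢α a≢β | small b≡α =
        a , c , a≢c , (a≢α , a≢β) , sharer-of-mover b≢c Db≡Dc (λ (b≢α , _) → b≢α b≡α) ,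
        refl , sym (trans Da≡Db Db≡Dc)
      ... | other a≢α a≢β | large b≡β =
        a , c , a≢c , (a≢α , a≢β) , sharer-of-mover b≢c Db≡Dc (λ (_ , b≢β) → b≢β b≡β) ,
        refl , sym (trans Da≡Db Db≡Dc)
      ... | small a≡α | _ =
        b , c , b≢c , sharer-of-mover a≢b Da≡Db (λ (a≢α , _) → a≢α a≡α) ,
        sharer-of-mover a≢c (trans Da≡Db Db≡Dc) (λ (a≢α , _) → a≢α a≡α) ,
        sym Da≡Db , sym (trans Da≡Db Db≡Dc)
      ... | large a≡β | _ =
        b , c , b≢c , sharer-of-mover a≢b Da≡Db (λ (_ , a≢β) → a≢β a≡β) ,
        sharer-of-mover a≢c (trans Da≡Db Db≡Dc) (λ (_ , a≢β) → a≢β a≡β) ,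
        sym Da≡Db , sym (trans Da≡Db Db≡Dc)

      at-most-two-after : ∀ {a b c t} → a ≢ b → b ≢ c → a ≢ c →
                          D a ≡ t → D b ≡ t → D c ≡ t → ⊥
      at-most-two-after {a} {b} {c} a≢b b≢c a≢c Da Db Dc
        with two-others a≢b b≢c a≢c (trans Da (sym Db)) (trans Db (sym Dc))
      ... | x , y , x≢y , ox , oy , Dx , Dy =
        let away-pred , _ , away-suc = others-apart x≢y ox oy Dx Dy
            stays : ∀ {γ} → D γ ≡ D a → C γ ≡ D a
            stays Dγ = trans (sym (D-other (away-from-movers Dγ away-pred away-suc))) Dγ
        in at-most-two a≢b b≢c a≢c (stays refl) (stays (trans Db (sym Da))) (stays (trans Dc (sym Da)))

      DoubledOrigin : ℤ → Set
      DoubledOrigin t = (Doubled C t × t ≢ pred s × t ≢ ℤ.suc s) ⊎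
                        (t ≡ pred s × ∃ λ γ → C γ ≡ pred s) ⊎
                        (t ≡ ℤ.suc s × ∃ λ γ → C γ ≡ ℤ.suc s)

      beside-mover : ∀ {μ γ t} → Role μ → ¬ IsOther μ → IsOther γ → D μ ≡ t → D γ ≡ t → DoubledOrigin t
      beside-mover (small refl) _ oγ Dμ Dγ =
        inj₂ (inj₁ (trans (sym Dμ) D-small , _ , trans (sym (D-other oγ)) (trans Dγ (trans (sym Dμ) D-small))))
      beside-mover (large refl) _ oγ Dμ Dγ =
        inj₂ (inj₂ (trans (sym Dμ) D-large , _ , trans (sym (D-other oγ)) (trans Dγ (trans (sym Dμ) D-large))))
      beside-mover (other μ≢α μ≢β) μ-moves _ _ _ = ⊥-elim (μ-moves (μ≢α , μ≢β))

      doubled-after : ∀ {t} → Doubled D t → DoubledOrigin t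
      doubled-after {t} (x , y , x≢y , Dx , Dy) with role x | role y
      ... | other x≢α x≢β | other y≢α y≢β =
        let away-pred , _ , away-suc = others-apart x≢y (x≢α , x≢β) (y≢α , y≢β) Dx Dy
        in inj₁ ((x , y , x≢y , trans (sym (D-other (x≢α , x≢β))) Dx ,
                                trans (sym (D-other (y≢α , y≢β))) Dy) , away-pred , away-suc)
      ... | other x≢α x≢β | small y≡α =
        beside-mover (small y≡α) (λ (y≢α , _) → y≢α y≡α) (x≢α , x≢β) Dy Dx
      ... | other x≢α x≢β | large y≡β =
        beside-mover (large y≡β) (λ (_ , y≢β) → y≢β y≡β) (x≢α , x≢β) Dy Dx
      ... | small x≡α | _ = beside-mover (small x≡α) x-moves
                              (sharer-of-mover x≢y (trans Dx (sym Dy)) x-moves) Dx Dy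
        where x-moves = λ ((x≢α , _) : IsOther x) → x≢α x≡α
      ... | large x≡β | _ = beside-mover (large x≡β) x-moves
                              (sharer-of-mover x≢y (trans Dx (sym Dy)) x-moves) Dx Dy
        where x-moves = λ ((_ , x≢β) : IsOther x) → x≢β x≡β

      private
        Gap : ℤ → ℤ → Set
        Gap t u = ∃ λ z → t < z × z < u × Vacant D z

        not-doubled-at-s : ∀ {t} → Doubled D t → t ≢ s
        not-doubled-at-s (x , _ , _ , Dx , _) refl = vacated x Dx

        gap-below : ∀ {t u} → Doubled D t → Doubled D u → t < u → u < s → Gap t u
        gap-below {t} {u} dt du t<u u<s with doubled-after dt | doubled-after du
        ... | inj₁ (dCt , _) | inj₁ (dCu , _) =
          let z , t<z , z<u , vacant = vacancy-between dCt dCu t<u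
          in z , t<z , z<u ,
             still-vacant vacant
               (λ z≡pred → nothing-between-pred-and-self (subst (_< u) z≡pred z<u) u<s)
               (λ z≡suc → ℤP.<-asym (ℤP.<-trans (subst (_< u) z≡suc z<u) u<s) (self<suc s))
        ... | inj₁ (dCt , _) | inj₂ (inj₁ (refl , γ , Cγ)) =
          let z , t<z , z<s , vacant = vacancy-between dCt doubled-at-s (ℤP.<-trans t<u u<s)
              z≢pred = λ z≡pred → vacant γ (trans Cγ (sym z≡pred))
          in z , t<z , ℤP.≤∧≢⇒< (ℤP.i<j⇒i≤pred[j] z<s) z≢pred ,
             still-vacant vacant z≢pred
               (λ z≡suc → ℤP.<-asym (subst (_< s) z≡suc z<s) (self<suc s))
        ... | inj₁ _ | inj₂ (inj₂ (refl , _)) = ⊥-elim (ℤP.<-asym u<s (self<suc s))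
        ... | inj₂ (inj₁ (refl , _)) | _ = ⊥-elim (nothing-between-pred-and-self t<u u<s)
        ... | inj₂ (inj₂ (refl , _)) | _ = ⊥-elim (ℤP.<-asym (ℤP.<-trans t<u u<s) (self<suc s))

        gap-above : ∀ {t u} → Doubled D t → Doubled D u → t < u → s < t → Gap t u
        gap-above {t} {u} dt du t<u s<t with doubled-after dt | doubled-after du
        ... | inj₁ (dCt , _) | inj₁ (dCu , _) =
          let z , t<z , z<u , vacant = vacancy-between dCt dCu t<u
          in z , t<z , z<u ,
             still-vacant vacant
               (λ z≡pred → ℤP.<-asym (ℤP.<-trans s<t (subst (t <_) z≡pred t<z)) (pred<self s))
               (λ z≡suc → nothing-between-self-and-suc s<t (subst (t <_) z≡suc t<z))
        ... | inj₂ (inj₂ (refl , γ , Cγ)) | inj₁ (dCu , _) =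
          let z , s<z , z<u , vacant = vacancy-between doubled-at-s dCu (ℤP.<-trans s<t t<u)
              z≢suc = λ z≡suc → vacant γ (trans Cγ (sym z≡suc))
          in z , ℤP.≤∧≢⇒< (ℤP.i<j⇒suc[i]≤j s<z) (λ e → z≢suc (sym e)) , z<u ,
             still-vacant vacant
               (λ z≡pred → ℤP.<-asym (subst (s <_) z≡pred s<z) (pred<self s)) z≢suc
        ... | inj₂ (inj₁ (refl , _)) | _ = ⊥-elim (ℤP.<-asym s<t (pred<self s))
        ... | _ | inj₂ (inj₁ (refl , _)) = ⊥-elim (ℤP.<-asym (ℤP.<-trans s<t t<u) (pred<self s))
        ... | _ | inj₂ (inj₂ (refl , _)) = ⊥-elim (nothing-between-self-and-suc s<t t<u)

      vacancy-between-after : ∀ {t u} → Doubled D t → Doubled D u → t < u → Gap t u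
      vacancy-between-after {t} {u} dt du t<u with ℤP.<-cmp u s | ℤP.<-cmp t s
      ... | tri< u<s _ _ | _ = gap-below dt du t<u u<s
      ... | tri≈ _ u≡s _ | _ = ⊥-elim (not-doubled-at-s du u≡s)
      ... | tri> _ _ _   | tri≈ _ t≡s _ = ⊥-elim (not-doubled-at-s dt t≡s)
      ... | tri> _ _ s<u | tri< t<s _ _ = s , t<s , s<u , vacated
      ... | tri> _ _ _   | tri> _ _ s<t = gap-above dt du t<u s<t

      tame-after : Tame D
      tame-after = record { at-most-two = at-most-two-after ; vacancy-between = vacancy-between-after }

    Tame-step : ∀ {C D : Config n} → Tame C → Topple C D → Tame D
    Tame-step tame t =
      let _ , _ , α<β , same , D≈ = Topple⇒topple t
      in Tame-resp (≈-sym D≈) (Toppled.tame-after tame (FinP.<⇒≢ α<β) same)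

    same-site-same-pair : ∀ {C : Config n} {α β α′ β′} → Tame C → α <ᶠ β → α′ <ᶠ β′ →
                          C α ≡ C β → C α′ ≡ C β′ → C α ≡ C α′ → α ≡ α′ × β ≡ β′
    same-site-same-pair {C} {α} {β} {α′} {β′} tame α<β α′<β′ same same′ α~α′
      with α ≟ α′ | β ≟ β′ | α′ ≟ β
    ... | yes α≡α′ | yes β≡β′ | _ = α≡α′ , β≡β′
    ... | yes refl | no β≢β′  | _ =
      ⊥-elim (at-most-two (FinP.<⇒≢ α<β) β≢β′ (FinP.<⇒≢ α′<β′) refl (sym same) β′-at)
      where open Tame tame
            β′-at = trans (sym same′) (sym α~α′)
    ... | no α≢α′ | _ | no α′≢β =
      ⊥-elim (at-most-two (FinP.<⇒≢ α<β) (λ e → α′≢β (sym e)) α≢α′ refl (sym same) (sym α~α′))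
      where open Tame tame
    ... | no α≢α′ | _ | yes refl =
      ⊥-elim (at-most-two (FinP.<⇒≢ α<β) (FinP.<⇒≢ α′<β′) β′≢α refl (sym same)
                          (trans (sym same′) (sym α~α′)))
      where open Tame tame
            β′≢α : α ≢ β′
            β′≢α refl = FinP.<-asym α<β α′<β′

    private
      join : ∀ {C D₁ D₂ : Config n} {α β α′ β′} → Tame C →
             α <ᶠ β → C α ≡ C β → D₁ ≈ topple C α β →
             α′ <ᶠ β′ → C α′ ≡ C β′ → D₂ ≈ topple C α′ β′ →
             D₁ ≈ D₂ ⊎ ∃ λ E → Topple D₁ E × Topple D₂ E
      join {C} {D₁} {D₂} {α} {β} {α′} {β′} tame α<β same D₁≈ α′<β′ same′ D₂≈
        with C α ℤ.≟ C α′
      ... | yes α~α′ = inj₁ (same-toppling (same-site-same-pair tame α<β α′<β′ same same′ α~α′))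
        where
          same-toppling : α ≡ α′ × β ≡ β′ → D₁ ≈ D₂
          same-toppling (refl , refl) = ≈-trans D₁≈ (≈-sym D₂≈)
      ... | no α≁α′ =
        inj₂ (topple (topple C α β) α′ β′ ,
              Topple-resp (≈-sym D₁≈) (λ _ → refl) (topple-Topple α′<β′ pair′-after) ,
              Topple-resp (≈-sym D₂≈) (topple-comm C α′ β′ α β) (topple-Topple α<β pair-after))
        where
          α′≢α : α′ ≢ α
          α′≢α e = α≁α′ (cong C (sym e))
          α′≢β : α′ ≢ β
          α′≢β e = α≁α′ (trans same (cong C (sym e)))
          β′≢α : β′ ≢ α
          β′≢α e = α≁α′ (trans (cong C (sym e)) (sym same′))
          β′≢β : β′ ≢ β
          β′≢β e = α≁α′ (trans same (trans (cong C (sym e)) (sym same′)))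
          pair′-after : topple C α β α′ ≡ topple C α β β′
          pair′-after = trans (topple-other C α′≢α α′≢β) (trans same′ (sym (topple-other C β′≢α β′≢β)))
          pair-after : topple C α′ β′ α ≡ topple C α′ β′ β
          pair-after = trans (topple-other C (λ e → α′≢α (sym e)) (λ e → β′≢α (sym e)))
                       (trans same (sym (topple-other C (λ e → α′≢β (sym e)) (λ e → β′≢β (sym e)))))

    topplings-join : ∀ {C D₁ D₂ : Config n} → Tame C → Topple C D₁ → Topple C D₂ →
                     D₁ ≈ D₂ ⊎ ∃ λ E → Topple D₁ E × Topple D₂ E
    topplings-join tame t₁ t₂ =
      let _ , _ , α<β , same , D₁≈ = Topple⇒topple t₁
          _ , _ , α′<β′ , same′ , D₂≈ = Topple⇒topple t₂
      in join tame α<β same D₁≈ α′<β′ same′ D₂≈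

    data Steps : ℕ → Config n → Config n → Set where
      done : ∀ {C} → Steps 0 C C
      step : ∀ {k C D E} → Topple C D → Steps k D E → Steps (suc k) C E

    Star⇒Steps : ∀ {C D : Config n} → Star Topple C D → ∃ λ k → Steps k C D
    Star⇒Steps ε = 0 , done
    Star⇒Steps (t ◅ ts) = let k , steps = Star⇒Steps ts in suc k , step t steps

    Steps⇒Star : ∀ {k} {C D : Config n} → Steps k C D → Star Topple C D
    Steps⇒Star done = ε
    Steps⇒Star (step t steps) = t ◅ Steps⇒Star steps

    _++ˢ_ : ∀ {k l} {C D E : Config n} → Steps k C D → Steps l D E → Steps (k ℕ.+ l) C E
    done ++ˢ steps′ = steps′
    step t steps ++ˢ steps′ = step t (steps ++ˢ steps′)

    Steps-resp : ∀ {k} {C C′ E : Config n} → C ≈ C′ → Steps k C E →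
                 ∃ λ E′ → Steps k C′ E′ × E ≈ E′
    Steps-resp {C′ = C′} C≈C′ done = C′ , done , C≈C′
    Steps-resp {E = E} C≈C′ (step t steps) = E , step (Topple-resp C≈C′ (λ _ → refl) t) steps , λ _ → refl

    -- Induction on k.  When the first steps differ, completing their join E from
    -- D₁ gives a path of length k − 1 from D₂, to which the hypothesis applies.
    completes-to : ∀ k {C F : Config n} → Tame C → Steps k C F → Stable F →
                   ∀ {m D} → Steps m C D → ∃ λ r → r ℕ.+ m ≡ k × ∃ λ F′ → Steps r D F′ × F′ ≈ F
    completes-to k {F = F} tame toF stable done = k , ℕP.+-identityʳ k , F , toF , λ _ → refl
    completes-to .0 tame done stable (step t _) = ⊥-elim (Stable⇒¬Topple stable t)
    completes-to (suc k) tame (step t₁ toF) stable {suc m} (step t₂ toD)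
      with topplings-join tame t₁ t₂
    ... | inj₁ D₁≈D₂ =
      let F₂ , toF₂ , F≈F₂ = Steps-resp D₁≈D₂ toF
          r , r+m≡k , F′ , toF′ , F′≈F₂ =
            completes-to k (Tame-step tame t₂) toF₂ (Stable-resp F≈F₂ stable) toD
      in r , trans (ℕP.+-suc r m) (cong suc r+m≡k) , F′ , toF′ , ≈-trans F′≈F₂ (≈-sym F≈F₂)
    ... | inj₂ (E , t₁′ , t₂′) =
      let r₁ , r₁+1≡k , F₁ , E→F₁ , F₁≈F = completes-to k (Tame-step tame t₁) toF stable (step t₁′ done)
          D₂→F₁ = subst (λ j → Steps j _ F₁) (trans (ℕP.+-comm 1 r₁) r₁+1≡k) (step t₂′ E→F₁)
          r , r+m≡k , F′ , toF′ , F′≈F₁ =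
            completes-to k (Tame-step tame t₂) D₂→F₁ (Stable-resp (≈-sym F₁≈F) stable) toD
      in r , trans (ℕP.+-suc r m) (cong suc r+m≡k) , F′ , toF′ , ≈-trans F′≈F₁ F₁≈F

    stable-result-unique : ∀ {k} {C F G : Config n} → Tame C → Steps k C F → Stable F →
                           Star Topple C G → Stable G → G ≈ F
    stable-result-unique tame toF stableF toG stableG
      with completes-to _ tame toF stableF (proj₂ (Star⇒Steps toG))
    ... | 0 , _ , _ , done , G≈F = G≈F
    ... | suc _ , _ , _ , step t _ , _ = ⊥-elim (Stable⇒¬Topple stableG t)

module Run where

  open import Defs
  open Confluence
  open import Data.Nat as ℕ using (ℕ; zero; suc; _+_; _∸_; _≤_; _<_; z≤n; s≤s; _≤?_)
  import Data.Nat.Properties as ℕP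
  open import Data.Integer as ℤ using (+_)
  import Data.Integer.Properties as ℤP
  open import Data.Fin as F using (toℕ) renaming (_<_ to _<ᶠ_)
  import Data.Fin.Properties as FinP
  open import Data.Nat.Induction using (<-wellFounded)
  open import Data.Product using (Σ; ∃; ∃₂; _×_; _,_; proj₁; proj₂)
  open import Data.Sum using (_⊎_; inj₁; inj₂)
  open import Data.Empty using (⊥-elim)
  open import Function.Bundles using (_⇔_; mk⇔)
  open import Function.Construct.Composition using (_⇔-∘_)
  open import Function.Construct.Identity using (⇔-id)
  open import Induction.WellFounded using (Acc; acc)
  open import Relation.Nullary using (¬_; Dec; yes; no)
  open import Relation.Binary using (tri<; tri≈; tri>)
  open import Relation.Binary.PropositionalEquality

  site-injective : ∀ {n} {C : Config n} {γ δ x y} → γ ≡ δ → C γ ≡ + x → C δ ≡ + y → x ≡ y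
  site-injective refl Cγ Cδ = ℤP.+-injective (trans (sym Cγ) Cδ)

  different-sites : ∀ {n} (C : Config n) {γ δ x y} → C γ ≡ + x → C δ ≡ + y → x ≢ y → γ ≢ δ
  different-sites C Cγ Cδ x≢y γ≡δ = x≢y (site-injective γ≡δ Cγ Cδ)

  module ToppleAt {n : ℕ} (C : Config n) {x y : Chip n} (x≢y : x ≢ y) (h : ℕ)
                  (Cx : C x ≡ + suc h) (Cy : C y ≡ + suc h) where

    private
      ordered : ∃₂ λ α β → α <ᶠ β × ((α ≡ x × β ≡ y) ⊎ (α ≡ y × β ≡ x))
      ordered with FinP.<-cmp x y
      ... | tri< x<y _ _ = x , y , x<y , inj₁ (refl , refl)
      ... | tri≈ _ x≡y _ = ⊥-elim (x≢y x≡y)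
      ... | tri> _ _ y<x = y , x , y<x , inj₂ (refl , refl)

    small large : Chip n
    small = proj₁ ordered
    large = proj₁ (proj₂ ordered)

    small<large : small <ᶠ large
    small<large = proj₁ (proj₂ (proj₂ ordered))

    pair : (small ≡ x × large ≡ y) ⊎ (small ≡ y × large ≡ x)
    pair = proj₂ (proj₂ (proj₂ ordered))

    D : Config n
    D = topple C small large

    small-site : C small ≡ + suc h
    small-site with pair
    ... | inj₁ (small≡x , _) = trans (cong C small≡x) Cx
    ... | inj₂ (small≡y , _) = trans (cong C small≡y) Cy

    large-site : C large ≡ + suc h
    large-site with pair
    ... | inj₁ (_ , large≡y) = trans (cong C large≡y) Cy
    ... | inj₂ (_ , large≡x) = trans (cong C large≡x) Cx

    toppling : Topple C D
    toppling = topple-Topple small<large (trans small-site (sym large-site))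

    D-small : D small ≡ + h
    D-small = trans (topple-small C small large) (cong (ℤ._- + 1) small-site)

    D-large : D large ≡ + suc (suc h)
    D-large = trans (topple-large C (FinP.<⇒≢ small<large))
                    (trans (cong (ℤ._+ + 1) large-site) (cong +_ (ℕP.+-comm (suc h) 1)))

    D-other : ∀ {γ} → γ ≢ x → γ ≢ y → D γ ≡ C γ
    D-other {γ} γ≢x γ≢y with pair
    ... | inj₁ (small≡x , large≡y) =
      topple-other C (λ e → γ≢x (trans e small≡x)) (λ e → γ≢y (trans e large≡y))
    ... | inj₂ (small≡y , large≡x) =
      topple-other C (λ e → γ≢y (trans e small≡y)) (λ e → γ≢x (trans e large≡x))

    D-away : ∀ {γ z} → C γ ≡ + z → z ≢ suc h → D γ ≡ C γ
    D-away Cγ z≢ = D-other (different-sites C Cγ Cx z≢) (different-sites C Cγ Cy z≢)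

    in-pair : ∀ {γ} → γ ≡ x ⊎ γ ≡ y → γ ≡ small ⊎ γ ≡ large
    in-pair γ∈ with pair | γ∈
    ... | inj₁ (small≡x , _) | inj₁ γ≡x = inj₁ (trans γ≡x (sym small≡x))
    ... | inj₁ (_ , large≡y) | inj₂ γ≡y = inj₂ (trans γ≡y (sym large≡y))
    ... | inj₂ (_ , large≡x) | inj₁ γ≡x = inj₂ (trans γ≡x (sym large≡x))
    ... | inj₂ (small≡y , _) | inj₂ γ≡y = inj₁ (trans γ≡y (sym small≡y))

    small-≤ : ∀ {γ} → γ ≡ x ⊎ γ ≡ y → toℕ small ≤ toℕ γ
    small-≤ γ∈ with in-pair γ∈
    ... | inj₁ refl = ℕP.≤-refl
    ... | inj₂ refl = ℕP.<⇒≤ small<large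

    ≤-large : ∀ {γ} → γ ≡ x ⊎ γ ≡ y → toℕ γ ≤ toℕ large
    ≤-large γ∈ with in-pair γ∈
    ... | inj₁ refl = ℕP.<⇒≤ small<large
    ... | inj₂ refl = ℕP.≤-refl

    site-after : ∀ γ {z} → D γ ≡ + z →
                 (γ ≡ small × z ≡ h) ⊎ (γ ≡ large × z ≡ suc (suc h)) ⊎ (γ ≢ x × γ ≢ y × C γ ≡ + z)
    site-after γ Dγ with γ F.≟ x | γ F.≟ y
    ... | no γ≢x | no γ≢y = inj₂ (inj₂ (γ≢x , γ≢y , trans (sym (D-other γ≢x γ≢y)) Dγ))
    ... | yes γ≡x | _ = mover (in-pair (inj₁ γ≡x))
      where
        mover : γ ≡ small ⊎ γ ≡ large → _
        mover (inj₁ refl) = inj₁ (refl , site-injective {C = D} refl Dγ D-small)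
        mover (inj₂ refl) = inj₂ (inj₁ (refl , site-injective {C = D} refl Dγ D-large))
    ... | no _ | yes γ≡y = mover (in-pair (inj₂ γ≡y))
      where
        mover : γ ≡ small ⊎ γ ≡ large → _
        mover (inj₁ refl) = inj₁ (refl , site-injective {C = D} refl Dγ D-small)
        mover (inj₂ refl) = inj₂ (inj₁ (refl , site-injective {C = D} refl Dγ D-large))

  override : ∀ {A : Set} → (ℕ → A) → ℕ → A → ℕ → A
  override f h v i with i ℕ.≟ h
  ... | yes _ = v
  ... | no _  = f i

  override-at : ∀ {A : Set} (f : ℕ → A) h v → override f h v h ≡ v
  override-at f h v with h ℕ.≟ h
  ... | yes _   = refl
  ... | no h≢h = ⊥-elim (h≢h refl)

  override-elsewhere : ∀ {A : Set} (f : ℕ → A) h v {i} → i ≢ h → override f h v i ≡ f i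
  override-elsewhere f h v {i} i≢h with i ℕ.≟ h
  ... | yes i≡h = ⊥-elim (i≢h i≡h)
  ... | no _    = refl

  ≢suc : ∀ {x} → x ≢ suc x
  ≢suc ()

  <⇒≢ : ∀ {x y} → x < y → x ≢ y
  <⇒≢ x<y refl = ℕP.<-irrefl refl x<y

  >⇒≢ : ∀ {x y} → y < x → x ≢ y
  >⇒≢ y<x refl = ℕP.<-irrefl refl y<x

  module IncreasingAroundHole {N h : ℕ} (S : ℕ → ℕ)
           (increasing : ∀ ℓ → suc ℓ ≤ N → S ℓ < S (suc ℓ))
           (bounded : ∀ ℓ → ℓ ≤ N → S ℓ ≤ suc N)
           (misses : ∀ ℓ → ℓ ≤ N → S ℓ ≢ suc h) where

    spread : ∀ d ℓ → ℓ + d ≤ N → S ℓ + d ≤ S (ℓ + d)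
    spread zero ℓ _ = ℕP.≤-reflexive (trans (ℕP.+-identityʳ (S ℓ)) (cong S (sym (ℕP.+-identityʳ ℓ))))
    spread (suc d) ℓ ℓ+d<N = begin
      S ℓ + suc d       ≡⟨ ℕP.+-suc (S ℓ) d ⟩
      suc (S ℓ + d)     ≤⟨ s≤s (spread d ℓ (ℕP.≤-trans (ℕP.n≤1+n _) ℓ+d+1≤N)) ⟩
      suc (S (ℓ + d))   ≤⟨ increasing (ℓ + d) ℓ+d+1≤N ⟩
      S (suc (ℓ + d))   ≡⟨ cong S (ℕP.+-suc ℓ d) ⟨
      S (ℓ + suc d)     ∎
      where
        open ℕP.≤-Reasoning
        ℓ+d+1≤N : suc (ℓ + d) ≤ N
        ℓ+d+1≤N = subst (_≤ N) (ℕP.+-suc ℓ d) ℓ+d<N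

    ≤-image : ∀ ℓ → ℓ ≤ N → ℓ ≤ S ℓ
    ≤-image ℓ ℓ≤N = ℕP.≤-trans (ℕP.m≤n+m ℓ (S 0)) (spread ℓ 0 ℓ≤N)

    image-≤ : ∀ ℓ → ℓ ≤ N → S ℓ ≤ suc ℓ
    image-≤ ℓ ℓ≤N = ℕP.+-cancelʳ-≤ (N ∸ ℓ) (S ℓ) (suc ℓ) (begin
      S ℓ + (N ∸ ℓ)     ≤⟨ spread (N ∸ ℓ) ℓ (ℕP.≤-reflexive ℓ+[N∸ℓ]≡N) ⟩
      S (ℓ + (N ∸ ℓ))   ≡⟨ cong S ℓ+[N∸ℓ]≡N ⟩
      S N               ≤⟨ bounded N ℕP.≤-refl ⟩
      suc N             ≡⟨ cong suc ℓ+[N∸ℓ]≡N ⟨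
      suc ℓ + (N ∸ ℓ)   ∎)
      where
        open ℕP.≤-Reasoning
        ℓ+[N∸ℓ]≡N = ℕP.m+[n∸m]≡n ℓ≤N

    below-hole : ∀ ℓ → ℓ ≤ h → h ≤ N → S ℓ ≡ ℓ
    below-hole ℓ ℓ≤h h≤N with S ℓ ℕ.≟ ℓ
    ... | yes Sℓ≡ℓ = Sℓ≡ℓ
    ... | no Sℓ≢ℓ = ⊥-elim (misses h h≤N (ℕP.≤-antisym (image-≤ h h≤N) (begin
      suc h             ≡⟨ cong suc (ℕP.m+[n∸m]≡n ℓ≤h) ⟨
      suc ℓ + (h ∸ ℓ)   ≤⟨ ℕP.+-monoˡ-≤ (h ∸ ℓ) (ℕP.≤∧≢⇒< (≤-image ℓ ℓ≤N) (λ e → Sℓ≢ℓ (sym e))) ⟩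
      S ℓ + (h ∸ ℓ)     ≤⟨ spread (h ∸ ℓ) ℓ (ℕP.≤-trans (ℕP.≤-reflexive (ℕP.m+[n∸m]≡n ℓ≤h)) h≤N) ⟩
      S (ℓ + (h ∸ ℓ))   ≡⟨ cong S (ℕP.m+[n∸m]≡n ℓ≤h) ⟩
      S h               ∎)))
      where
        open ℕP.≤-Reasoning
        ℓ≤N = ℕP.≤-trans ℓ≤h h≤N

    above-hole : ∀ ℓ → h < ℓ → ℓ ≤ N → S ℓ ≡ suc ℓ
    above-hole ℓ h<ℓ ℓ≤N with S ℓ ℕ.≟ suc ℓ
    ... | yes Sℓ≡ = Sℓ≡
    ... | no Sℓ≢ = ⊥-elim (misses (suc h) h+1≤N (ℕP.≤-antisym
      (ℕP.+-cancelʳ-≤ (ℓ ∸ suc h) (S (suc h)) (suc h) (begin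
        S (suc h) + (ℓ ∸ suc h)   ≤⟨ spread (ℓ ∸ suc h) (suc h) (ℕP.≤-trans (ℕP.≤-reflexive ℓ≡) ℓ≤N) ⟩
        S (suc h + (ℓ ∸ suc h))   ≡⟨ cong S ℓ≡ ⟩
        S ℓ                       ≤⟨ ℕP.≤-pred (ℕP.≤∧≢⇒< (image-≤ ℓ ℓ≤N) Sℓ≢) ⟩
        ℓ                         ≡⟨ ℓ≡ ⟨
        suc h + (ℓ ∸ suc h)       ∎))
      (≤-image (suc h) h+1≤N)))
      where
        open ℕP.≤-Reasoning
        ℓ≡ = ℕP.m+[n∸m]≡n h<ℓ
        h+1≤N = ℕP.≤-trans h<ℓ ℓ≤N

  module InjectiveBelow {N h : ℕ} (S : ℕ → ℕ) (h≤N : h ≤ N)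
           (injective : ∀ ℓ ℓ′ → ℓ ≤ N → ℓ′ ≤ N → S ℓ ≡ S ℓ′ → ℓ ≡ ℓ′)
           (not-up : ∀ ℓ → ℓ ≤ h → S ℓ ≤ ℓ) where

    fixed : ∀ ℓ → ℓ ≤ h → S ℓ ≡ ℓ
    fixed ℓ = go ℓ (<-wellFounded ℓ)
      where
        go : ∀ ℓ → Acc _<_ ℓ → ℓ ≤ h → S ℓ ≡ ℓ
        go ℓ (acc smaller) ℓ≤h with S ℓ ℕ.≟ ℓ
        ... | yes Sℓ≡ℓ = Sℓ≡ℓ
        ... | no Sℓ≢ℓ = ⊥-elim (<⇒≢ Sℓ<ℓ (injective (S ℓ) ℓ (ℕP.≤-trans (ℕP.<⇒≤ Sℓ<ℓ) ℓ≤N) ℓ≤N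
                                            (go (S ℓ) (smaller Sℓ<ℓ) (ℕP.≤-trans (ℕP.<⇒≤ Sℓ<ℓ) ℓ≤h))))
          where
            Sℓ<ℓ = ℕP.≤∧≢⇒< (not-up ℓ ℓ≤h) Sℓ≢ℓ
            ℓ≤N = ℕP.≤-trans ℓ≤h h≤N

  -- Shape a C is the configuration before pass a (m = n − p): site a carries two
  -- chips, every other site of [1, a + m] and of [a + m + 2, n + 1] one, and all
  -- other sites are empty.
  module Passes {n : ℕ} (m : ℕ) where

    record Shape (a : ℕ) (C : Config n) : Set where
      field
        extra : Chip n
        inner outer : ℕ → Chip n
        extra-site : C extra ≡ + a
        inner-site : ∀ j → 1 ≤ j → j ≤ a + m → C (inner j) ≡ + j
        outer-site : ∀ y → suc (suc (a + m)) ≤ y → y ≤ suc n → C (outer y) ≡ + y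
        extra≢inner : 1 ≤ a → extra ≢ inner a
        cover : ∀ γ → γ ≡ extra ⊎
                      (∃ λ j → 1 ≤ j × j ≤ a + m × γ ≡ inner j) ⊎
                      (∃ λ y → suc (suc (a + m)) ≤ y × y ≤ suc n × γ ≡ outer y)

    -- Pass a′ + 1 in progress: the carried chip has reached site h + 1, leaving h empty.
    record Sweep (a′ h : ℕ) (C : Config n) : Set where
      field
        extra carried : Chip n
        inner outer : ℕ → Chip n
        extra-site : C extra ≡ + a′
        carried-site : C carried ≡ + suc h
        inner-site : ∀ i → 1 ≤ i → i ≤ suc (a′ + m) → i ≢ h → C (inner i) ≡ + i
        outer-site : ∀ y → suc (suc (suc (a′ + m))) ≤ y → y ≤ suc n → C (outer y) ≡ + y
        extra≢inner : 1 ≤ a′ → extra ≢ inner a′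
        carried≢inner : suc h ≤ suc (a′ + m) → carried ≢ inner (suc h)
        cover : ∀ γ → γ ≡ extra ⊎ γ ≡ carried ⊎
                      (∃ λ i → 1 ≤ i × i ≤ suc (a′ + m) × i ≢ h × γ ≡ inner i) ⊎
                      (∃ λ y → suc (suc (suc (a′ + m))) ≤ y × y ≤ suc n × γ ≡ outer y)

    module SweepStart {a′ : ℕ} {C : Config n} (S : Shape (suc a′) C) where
      open Shape S
      open ToppleAt C (extra≢inner (s≤s z≤n)) a′ extra-site
                      (inner-site (suc a′) (s≤s z≤n) (s≤s (ℕP.m≤m+n a′ m))) public

      sweep : Sweep a′ (suc a′) D
      sweep = record
        { extra = small ; carried = large ; inner = inner ; outer = outer
        ; extra-site = D-small ; carried-site = D-large
        ; inner-site = λ i 1≤i i≤ i≢ →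
            trans (D-away (inner-site i 1≤i i≤) i≢) (inner-site i 1≤i i≤)
        ; outer-site = λ y y≥ y≤ →
            trans (D-away (outer-site y y≥ y≤) (>⇒≢ (ℕP.<-trans (s≤s (s≤s (ℕP.m≤m+n a′ m))) y≥)))
                  (outer-site y y≥ y≤)
        ; extra≢inner = λ 1≤a′ → different-sites C small-site
            (inner-site a′ 1≤a′ (ℕP.≤-trans (ℕP.n≤1+n a′) (s≤s (ℕP.m≤m+n a′ m)))) (λ e → ≢suc (sym e))
        ; carried≢inner = λ le → different-sites C large-site (inner-site (suc (suc a′)) (s≤s z≤n) le) (λ ())
        ; cover = cover′ }
        where
          from-pair : ∀ {γ} → γ ≡ small ⊎ γ ≡ large → _
          from-pair (inj₁ γ≡small) = inj₁ γ≡small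
          from-pair (inj₂ γ≡large) = inj₂ (inj₁ γ≡large)
          cover′ : ∀ γ → _
          cover′ γ with cover γ
          ... | inj₁ γ≡extra = from-pair (in-pair (inj₁ γ≡extra))
          ... | inj₂ (inj₂ outer-chip) = inj₂ (inj₂ (inj₂ outer-chip))
          ... | inj₂ (inj₁ (j , 1≤j , j≤ , γ≡)) with j ℕ.≟ suc a′
          ...   | yes refl = from-pair (in-pair (inj₂ γ≡))
          ...   | no j≢   = inj₂ (inj₂ (inj₁ (j , 1≤j , j≤ , j≢ , γ≡)))

    module SweepStep {a′ h : ℕ} {C : Config n} (a′<h : a′ < h) (h<end : suc h ≤ suc (a′ + m))
                     (S : Sweep a′ h C) where
      open Sweep S
      open ToppleAt C (carried≢inner h<end) h carried-site
                      (inner-site (suc h) (s≤s z≤n) h<end (λ ())) public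

      private
        1≤h : 1 ≤ h
        1≤h = ℕP.≤-trans (s≤s z≤n) a′<h
        h≤end : h ≤ suc (a′ + m)
        h≤end = ℕP.≤-trans (ℕP.n≤1+n h) h<end

      inner′ : ℕ → Chip n
      inner′ = override inner h small

      sweep : Sweep a′ (suc h) D
      sweep = record
        { extra = extra ; carried = large ; inner = inner′ ; outer = outer
        ; extra-site = trans (D-away extra-site (<⇒≢ (ℕP.<-trans a′<h (ℕP.n<1+n h)))) extra-site
        ; carried-site = D-large
        ; inner-site = inner-site′
        ; outer-site = λ y y≥ y≤ →
            trans (D-away (outer-site y y≥ y≤) (>⇒≢ (ℕP.<-trans (s≤s h<end) y≥))) (outer-site y y≥ y≤)
        ; extra≢inner = λ 1≤a′ e → extra≢inner 1≤a′ (trans e (override-elsewhere inner h small (<⇒≢ a′<h)))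
        ; carried≢inner = λ le e →
            different-sites C large-site (inner-site (suc (suc h)) (s≤s z≤n) le (λ ())) (λ ())
              (trans e (override-elsewhere inner h small (λ ())))
        ; cover = cover′ }
        where
          inner-site′ : ∀ i → 1 ≤ i → i ≤ suc (a′ + m) → i ≢ suc h → D (inner′ i) ≡ + i
          inner-site′ i 1≤i i≤ i≢ = site (i ℕ.≟ h)
            where
              site : Dec (i ≡ h) → D (inner′ i) ≡ + i
              site (yes refl) = trans (cong D (override-at inner i small)) D-small
              site (no i≢h) = trans (cong D (override-elsewhere inner h small i≢h))
                                    (trans (D-away (inner-site i 1≤i i≤ i≢h) i≢) (inner-site i 1≤i i≤ i≢h))
          from-pair : ∀ {γ} → γ ≡ small ⊎ γ ≡ large → _
          from-pair (inj₁ γ≡small) =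
            inj₂ (inj₂ (inj₁ (h , 1≤h , h≤end , (λ ()) , trans γ≡small (sym (override-at inner h small)))))
          from-pair (inj₂ γ≡large) = inj₂ (inj₁ γ≡large)
          cover′ : ∀ γ → _
          cover′ γ with cover γ
          ... | inj₁ γ≡extra = inj₁ γ≡extra
          ... | inj₂ (inj₁ γ≡carried) = from-pair (in-pair (inj₁ γ≡carried))
          ... | inj₂ (inj₂ (inj₂ outer-chip)) = inj₂ (inj₂ (inj₂ outer-chip))
          ... | inj₂ (inj₂ (inj₁ (i , 1≤i , i≤ , i≢h , γ≡))) with i ℕ.≟ suc h
          ...   | yes refl = from-pair (in-pair (inj₂ γ≡))
          ...   | no i≢ = inj₂ (inj₂ (inj₁ (i , 1≤i , i≤ , i≢ ,
                                           trans γ≡ (sym (override-elsewhere inner h small i≢h)))))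

    module SweepEnd {a′ : ℕ} {C : Config n} (fits : suc (a′ + m) ≤ n)
                    (S : Sweep a′ (suc (a′ + m)) C) where
      open Sweep S

      private
        b = suc (a′ + m)

      outer′ : ℕ → Chip n
      outer′ = override outer (suc b) carried

      shape : Shape a′ C
      shape = record
        { extra = extra ; inner = inner ; outer = outer′
        ; extra-site = extra-site
        ; inner-site = λ j 1≤j j≤ → inner-site j 1≤j (ℕP.≤-trans j≤ (ℕP.n≤1+n _)) (<⇒≢ (s≤s j≤))
        ; outer-site = outer-site′
        ; extra≢inner = extra≢inner
        ; cover = cover′ }
        where
          outer-site′ : ∀ y → suc b ≤ y → y ≤ suc n → C (outer′ y) ≡ + y
          outer-site′ y y≥ y≤ = site (y ℕ.≟ suc b)
            where
              site : Dec (y ≡ suc b) → C (outer′ y) ≡ + y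
              site (yes refl) = trans (cong C (override-at outer y carried)) carried-site
              site (no y≢) = trans (cong C (override-elsewhere outer (suc b) carried y≢))
                                   (outer-site y (ℕP.≤∧≢⇒< y≥ (λ e → y≢ (sym e))) y≤)
          cover′ : ∀ γ → _
          cover′ γ with cover γ
          ... | inj₁ γ≡extra = inj₁ γ≡extra
          ... | inj₂ (inj₁ γ≡carried) =
            inj₂ (inj₂ (suc b , ℕP.≤-refl , s≤s fits , trans γ≡carried (sym (override-at outer (suc b) carried))))
          ... | inj₂ (inj₂ (inj₁ (i , 1≤i , i≤ , i≢ , γ≡))) = inj₂ (inj₁ (i , 1≤i , ℕP.≤-pred (ℕP.≤∧≢⇒< i≤ i≢) , γ≡))
          ... | inj₂ (inj₂ (inj₂ (y , y≥ , y≤ , γ≡))) =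
            inj₂ (inj₂ (y , ℕP.<⇒≤ y≥ , y≤ , trans γ≡ (sym (override-elsewhere outer (suc b) carried (>⇒≢ y≥)))))

    impossible : ∀ {A : Set} {x y} → x < y → y ≤ x → A
    impossible x<y y≤x = ⊥-elim (ℕP.<⇒≱ x<y y≤x)

    record LabelBound (a ℓ x : ℕ) : Set where
      constructor label-bound
      field
        settled : suc (suc (a + m)) ≤ x → suc ℓ ≡ x
        windowed : x ≤ a + m → x ≤ ℓ + a × ℓ ≤ x + m

    LabelBounds : ℕ → Config n → Set
    LabelBounds a C = ∀ γ x → C γ ≡ + x → LabelBound a (toℕ γ) x

    -- Chips the carried one has passed obey the bounds of the next pass and have
    -- smaller labels than it; chips ahead of it obey those of the current pass.
    record ChipInvariant (a′ h ℓκ ℓ x : ℕ) : Set where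
      field
        left : x ≤ a′ → ℓ ≤ x + m
        passed : suc a′ ≤ x → x < h → x ≤ ℓ + a′ × ℓ ≤ x + m × ℓ < ℓκ
        ahead : suc h ≤ x → x ≤ suc (a′ + m) → x ≤ ℓ + suc a′ × ℓ ≤ x + m
        settled : suc (suc (suc (a′ + m))) ≤ x → suc ℓ ≡ x

    record SweepInvariant {a′ h C} (S : Sweep a′ h C) : Set where
      field
        extra<carried : toℕ (Sweep.extra S) < toℕ (Sweep.carried S)
        carried-bound : toℕ (Sweep.carried S) ≤ h + m
        chips : ∀ γ x → C γ ≡ + x → ChipInvariant a′ h (toℕ (Sweep.carried S)) (toℕ γ) x

    -- What the bounds after a pass force on a pass still in progress.
    record ChipNecessary (a′ h ℓ x : ℕ) : Set where
      field
        left : x ≤ a′ → ℓ ≤ x + m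
        passed : suc a′ ≤ x → x < h → x ≤ ℓ + a′
        ahead : suc h ≤ x → x ≤ suc (a′ + m) → x ≤ ℓ + suc a′
        settled : suc (suc (suc (a′ + m))) ≤ x → suc ℓ ≡ x
        unsettled : x ≤ suc (suc (a′ + m)) → ℓ ≤ suc (a′ + m)

    SweepNecessary : ∀ {a′ h C} → Sweep a′ h C → Set
    SweepNecessary {a′} {h} {C} S = ∀ γ x → C γ ≡ + x → ChipNecessary a′ h (toℕ γ) x

    off-the-double : ∀ {a C} (S : Shape a C) {γ z} → C γ ≡ + z →
                     γ ≢ Shape.extra S → γ ≢ Shape.inner S a → z ≢ a
    off-the-double {a} {C} S {γ} Cγ γ≢extra γ≢inner z≡a with Shape.cover S γ
    ... | inj₁ γ≡extra = γ≢extra γ≡extra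
    ... | inj₂ (inj₁ (j , 1≤j , j≤ , γ≡)) =
      γ≢inner (subst (λ i → γ ≡ Shape.inner S i)
                     (trans (sym (site-injective γ≡ Cγ (Shape.inner-site S j 1≤j j≤))) z≡a) γ≡)
    ... | inj₂ (inj₂ (y , y≥ , y≤ , γ≡)) =
      impossible (s≤s (ℕP.≤-trans (ℕP.m≤m+n a m) (ℕP.n≤1+n _)))
                 (ℕP.≤-trans y≥ (ℕP.≤-reflexive (trans (sym (site-injective γ≡ Cγ (Shape.outer-site S y y≥ y≤))) z≡a)))

    off-the-step : ∀ {a′ h C} (S : Sweep a′ h C) → a′ < h → suc h ≤ suc (a′ + m) → ∀ {γ z} → C γ ≡ + z →
                   γ ≢ Sweep.carried S → γ ≢ Sweep.inner S (suc h) → z ≢ h × z ≢ suc h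
    off-the-step {a′} {h} {C} S a′<h h<end {γ} {z} Cγ γ≢carried γ≢inner with Sweep.cover S γ
    ... | inj₁ γ≡extra =
      let z≡a′ = site-injective γ≡extra Cγ (Sweep.extra-site S)
      in (λ z≡h → <⇒≢ a′<h (trans (sym z≡a′) z≡h)) ,
         (λ z≡ → <⇒≢ (ℕP.<-trans a′<h (ℕP.n<1+n h)) (trans (sym z≡a′) z≡))
    ... | inj₂ (inj₁ γ≡carried) = ⊥-elim (γ≢carried γ≡carried)
    ... | inj₂ (inj₂ (inj₁ (i , 1≤i , i≤ , i≢h , γ≡))) =
      let z≡i = site-injective γ≡ Cγ (Sweep.inner-site S i 1≤i i≤ i≢h)
      in (λ z≡h → i≢h (trans (sym z≡i) z≡h)) ,
         (λ z≡ → γ≢inner (subst (λ j → γ ≡ Sweep.inner S j) (trans (sym z≡i) z≡) γ≡))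
    ... | inj₂ (inj₂ (inj₂ (y , y≥ , y≤ , γ≡))) =
      let z≡y = site-injective γ≡ Cγ (Sweep.outer-site S y y≥ y≤)
      in (λ z≡h → impossible (ℕP.≤-trans (s≤s (ℕP.≤-trans (ℕP.n≤1+n h) h<end)) (ℕP.n≤1+n _))
                             (subst (_ ≤_) (trans (sym z≡y) z≡h) y≥)) ,
         (λ z≡ → impossible (ℕP.≤-trans (s≤s h<end) (ℕP.n≤1+n _)) (subst (_ ≤_) (trans (sym z≡y) z≡) y≥))

    settled-site : ∀ {a C} (S : Shape a C) → LabelBounds a C →
                   ∀ γ z → C γ ≡ + z → suc (a + m) ≤ toℕ γ → z ≡ suc (toℕ γ)
    settled-site {C = C} S bounds γ z Cγ le = site-injective {C = C} (sym outer≡γ) Cγ outer-at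
      where
        y = suc (toℕ γ)
        outer-at = Shape.outer-site S y (s≤s le) (FinP.toℕ<n γ)
        outer≡γ : Shape.outer S y ≡ γ
        outer≡γ = FinP.toℕ-injective (ℕP.suc-injective
                    (LabelBound.settled (bounds (Shape.outer S y) y outer-at) (s≤s le)))

    start-invariant : ∀ {a′ C} (S : Shape (suc a′) C) → LabelBounds (suc a′) C →
                      SweepInvariant (SweepStart.sweep S)
    start-invariant {a′} {C} S bounds = record
      { extra<carried = small<large ; carried-bound = large-bound ; chips = chips }
      where
        open SweepStart S
        large-bound : toℕ large ≤ suc a′ + m
        large-bound = proj₂ (LabelBound.windowed (bounds large (suc a′) large-site) (s≤s (ℕP.m≤m+n a′ m)))
        chips : ∀ γ x → D γ ≡ + x → ChipInvariant a′ (suc a′) (toℕ large) (toℕ γ) x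
        chips γ x Dγ with site-after γ Dγ
        ... | inj₁ (refl , refl) = record
          { left = λ _ → ℕP.≤-pred (ℕP.≤-trans small<large large-bound)
          ; passed = λ x>a′ _ → impossible (ℕP.n<1+n a′) x>a′
          ; ahead = λ x>h _ → impossible (ℕP.≤-trans (ℕP.n<1+n a′) (ℕP.n≤1+n _)) x>h
          ; settled = λ x≥ → impossible (s≤s (ℕP.m≤n⇒m≤1+n (ℕP.m≤n⇒m≤1+n (ℕP.m≤m+n a′ m)))) x≥ }
        ... | inj₂ (inj₁ (refl , refl)) = record
          { left = λ x≤a′ → impossible (ℕP.≤-trans (ℕP.n<1+n a′) (ℕP.n≤1+n _)) x≤a′
          ; passed = λ _ x<h → impossible (ℕP.≤-trans (ℕP.n<1+n (suc a′)) (ℕP.n≤1+n _)) x<h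
          ; ahead = λ _ _ → ℕP.+-monoˡ-≤ (suc a′) (ℕP.≤-trans (s≤s z≤n) small<large) ,
                            ℕP.≤-trans large-bound (ℕP.n≤1+n _)
          ; settled = λ x≥ → impossible (s≤s (s≤s (s≤s (ℕP.m≤m+n a′ m)))) x≥ }
        ... | inj₂ (inj₂ (_ , _ , Cγ)) =
          let label-bound settled windowed = bounds γ x Cγ
          in record
            { left = λ x≤a′ → proj₂ (windowed (ℕP.≤-trans x≤a′ (ℕP.≤-trans (ℕP.m≤m+n a′ m) (ℕP.n≤1+n _))))
            ; passed = λ x>a′ x≤a′ → impossible x≤a′ x>a′
            ; ahead = λ _ x≤ → windowed x≤
            ; settled = settled }

    step-invariant : ∀ {a′ h C} (a′<h : a′ < h) (h<end : suc h ≤ suc (a′ + m)) (S : Sweep a′ h C) →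
                     SweepInvariant S → SweepInvariant (SweepStep.sweep a′<h h<end S)
    step-invariant {a′} {h} {C} a′<h h<end S inv = record
      { extra<carried = ℕP.<-≤-trans extra<carried (≤-large (inj₁ refl))
      ; carried-bound = large-bound
      ; chips = chips′ }
      where
        open SweepStep a′<h h<end S
        open SweepInvariant inv
        large-bound : toℕ large ≤ suc h + m
        large-bound = proj₂ (ChipInvariant.ahead (chips large (suc h) large-site) ℕP.≤-refl h<end)
        small-after : h ≤ toℕ small + a′
        small-after = ℕP.≤-pred (ℕP.≤-trans (proj₁ (ChipInvariant.ahead (chips small (suc h) small-site) ℕP.≤-refl h<end))
                                            (ℕP.≤-reflexive (ℕP.+-suc (toℕ small) a′)))
        chips′ : ∀ γ x → D γ ≡ + x → ChipInvariant a′ (suc h) (toℕ large) (toℕ γ) x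
        chips′ γ x Dγ with site-after γ Dγ
        ... | inj₁ (refl , refl) = record
          { left = λ h≤a′ → impossible a′<h h≤a′
          ; passed = λ _ _ → small-after , ℕP.≤-trans (small-≤ (inj₁ refl)) carried-bound , small<large
          ; ahead = λ h>h _ → impossible (ℕP.≤-trans (ℕP.n<1+n h) (ℕP.n≤1+n _)) h>h
          ; settled = λ h≥ → impossible (ℕP.≤-trans (s≤s (ℕP.≤-trans (ℕP.n≤1+n h) h<end)) (ℕP.n≤1+n _)) h≥ }
        ... | inj₂ (inj₁ (refl , refl)) = record
          { left = λ x≤a′ → impossible (ℕP.≤-trans a′<h (ℕP.≤-trans (ℕP.n≤1+n h) (ℕP.n≤1+n _))) x≤a′
          ; passed = λ _ x<h → impossible (ℕP.≤-trans (ℕP.n<1+n (suc h)) (ℕP.n≤1+n _)) x<h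
          ; ahead = λ _ _ →
              ℕP.≤-trans (s≤s (s≤s small-after))
                (ℕP.≤-trans (ℕP.≤-reflexive (cong suc (sym (ℕP.+-suc (toℕ small) a′))))
                            (ℕP.+-monoˡ-≤ (suc a′) small<large)) ,
              ℕP.≤-trans large-bound (ℕP.n≤1+n _)
          ; settled = λ x≥ → impossible (s≤s (s≤s h<end)) x≥ }
        ... | inj₂ (inj₂ (γ≢carried , γ≢inner , Cγ)) =
          let inv-γ = chips γ x Cγ
              x≢h , _ = off-the-step S a′<h h<end Cγ γ≢carried γ≢inner
              passed-γ = λ x>a′ x≤h → ChipInvariant.passed inv-γ x>a′ (ℕP.≤∧≢⇒< (ℕP.≤-pred x≤h) x≢h)
          in record
            { left = ChipInvariant.left inv-γ
            ; passed = λ x>a′ x≤h →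
                let x≤ , ≤x , below-carried = passed-γ x>a′ x≤h
                in x≤ , ≤x , ℕP.<-≤-trans below-carried (≤-large (inj₁ refl))
            ; ahead = λ x> x≤ → ChipInvariant.ahead inv-γ (ℕP.≤-trans (ℕP.n≤1+n _) x>) x≤
            ; settled = ChipInvariant.settled inv-γ }

    only-carried-beyond : ∀ {a′ C} (S : Sweep a′ (suc (a′ + m)) C) →
                          ∀ {δ} → C δ ≡ + suc (suc (a′ + m)) → δ ≡ Sweep.carried S
    only-carried-beyond {a′} {C} S {δ} Cδ with Sweep.cover S δ
    ... | inj₁ δ≡extra =
      impossible (s≤s (ℕP.≤-trans (ℕP.m≤m+n a′ m) (ℕP.n≤1+n _)))
                 (ℕP.≤-reflexive (site-injective {C = C} δ≡extra Cδ (Sweep.extra-site S)))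
    ... | inj₂ (inj₁ δ≡carried) = δ≡carried
    ... | inj₂ (inj₂ (inj₁ (i , 1≤i , i≤ , i≢ , δ≡))) =
      impossible (s≤s i≤) (ℕP.≤-reflexive (site-injective {C = C} δ≡ Cδ (Sweep.inner-site S i 1≤i i≤ i≢)))
    ... | inj₂ (inj₂ (inj₂ (y , y≥ , y≤ , δ≡))) =
      impossible (ℕP.n<1+n (suc (suc (a′ + m))))
                 (ℕP.≤-trans y≥ (ℕP.≤-reflexive (sym (site-injective {C = C} δ≡ Cδ (Sweep.outer-site S y y≥ y≤)))))

    -- The carried chip is at most b = a′ + m + 1 because every larger label is
    -- already settled, and at least b because the chip labelled b is nowhere else.
    carried-label-at-end : ∀ {a′ C} → suc (a′ + m) ≤ n → (S : Sweep a′ (suc (a′ + m)) C) →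
                           SweepInvariant S → toℕ (Sweep.carried S) ≡ suc (a′ + m)
    carried-label-at-end {a′} {C} fits S inv = ℕP.≤-antisym carried-≤ ≤-carried
      where
        open Sweep S
        open SweepInvariant inv
        b = suc (a′ + m)

        carried-≤ : toℕ carried ≤ b
        carried-≤ with toℕ carried ≤? b
        ... | yes ≤b = ≤b
        ... | no ≰b = ⊥-elim (<⇒≢ b<κ (sym (ℕP.suc-injective (site-injective {C = C} outer≡carried outer-at carried-site))))
          where
            b<κ = ℕP.≰⇒> ≰b
            outer-at = outer-site (suc (toℕ carried)) (s≤s b<κ) (FinP.toℕ<n carried)
            outer≡carried : outer (suc (toℕ carried)) ≡ carried
            outer≡carried = FinP.toℕ-injective (ℕP.suc-injective
                              (ChipInvariant.settled (chips _ _ outer-at) (s≤s b<κ)))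

        chip-b : Chip n
        chip-b = F.fromℕ< (s≤s fits)

        is-b : ∀ {δ} → chip-b ≡ δ → toℕ δ ≡ b
        is-b refl = FinP.toℕ-fromℕ< (s≤s fits)

        ≤-carried : b ≤ toℕ carried
        ≤-carried with cover chip-b
        ... | inj₁ e = ℕP.<⇒≤ (subst (_< toℕ carried) (is-b e) extra<carried)
        ... | inj₂ (inj₁ e) = ℕP.≤-reflexive (sym (is-b e))
        ... | inj₂ (inj₂ (inj₁ (i , 1≤i , i≤ , i≢ , e))) with i ≤? a′
        ...   | yes i≤a′ =
          impossible (s≤s (ℕP.+-monoˡ-≤ m i≤a′))
                     (subst (_≤ i + m) (is-b e) (ChipInvariant.left (chips _ i (inner-site i 1≤i i≤ i≢)) i≤a′))
        ...   | no i≰a′ =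
          ℕP.<⇒≤ (subst (_< toℕ carried) (is-b e)
                   (proj₂ (proj₂ (ChipInvariant.passed (chips _ i (inner-site i 1≤i i≤ i≢))
                                                       (ℕP.≰⇒> i≰a′) (ℕP.≤∧≢⇒< i≤ i≢)))))
        ≤-carried | inj₂ (inj₂ (inj₂ (y , y≥ , y≤ , e))) =
          impossible (ℕP.n<1+n (suc b))
            (ℕP.≤-trans y≥ (ℕP.≤-reflexive (sym (trans (cong suc (sym (is-b e)))
                                                       (ChipInvariant.settled (chips _ y (outer-site y y≥ y≤)) y≥)))))

    end-bounds : ∀ {a′ C} → suc (a′ + m) ≤ n → (S : Sweep a′ (suc (a′ + m)) C) →
                 SweepInvariant S → LabelBounds a′ C
    end-bounds {a′} {C} fits S inv γ z Cγ = label-bound settled′ windowed′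
      where
        open SweepInvariant inv
        b = suc (a′ + m)
        inv-γ = chips γ z Cγ

        settled′ : suc (suc (a′ + m)) ≤ z → suc (toℕ γ) ≡ z
        settled′ z≥ with z ℕ.≟ suc b
        ... | yes refl = cong suc (trans (cong toℕ (only-carried-beyond S Cγ)) (carried-label-at-end fits S inv))
        ... | no z≢ = ChipInvariant.settled inv-γ (ℕP.≤∧≢⇒< z≥ (λ e → z≢ (sym e)))

        windowed′ : z ≤ a′ + m → z ≤ toℕ γ + a′ × toℕ γ ≤ z + m
        windowed′ z≤ with z ≤? a′
        ... | yes z≤a′ = ℕP.≤-trans z≤a′ (ℕP.m≤n+m a′ (toℕ γ)) , ChipInvariant.left inv-γ z≤a′
        ... | no z≰a′ = let z≤ℓ , ℓ≤ , _ = ChipInvariant.passed inv-γ (ℕP.≰⇒> z≰a′) (s≤s z≤) in z≤ℓ , ℓ≤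

    end-necessary : ∀ {a′ C} (fits : suc (a′ + m) ≤ n) (S : Sweep a′ (suc (a′ + m)) C) →
                    LabelBounds a′ C → SweepNecessary S
    end-necessary {a′} fits S bounds γ z Cγ = record
      { left = λ z≤a′ → proj₂ (windowed (ℕP.≤-trans z≤a′ (ℕP.m≤m+n a′ m)))
      ; passed = λ _ z<b → proj₁ (windowed (ℕP.≤-pred z<b))
      ; ahead = λ z> z≤ → impossible z> z≤
      ; settled = λ z≥ → settled (ℕP.≤-trans (ℕP.n≤1+n _) z≥)
      ; unsettled = unsettled }
      where
        open LabelBound (bounds γ z Cγ)
        unsettled : z ≤ suc (suc (a′ + m)) → toℕ γ ≤ suc (a′ + m)
        unsettled z≤ with toℕ γ ≤? suc (a′ + m)
        ... | yes ℓ≤ = ℓ≤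
        ... | no ℓ≰ =
          impossible (s≤s (ℕP.≰⇒> ℓ≰))
            (ℕP.≤-trans (ℕP.≤-reflexive (sym (settled-site (SweepEnd.shape fits S) bounds γ z Cγ
                                                            (ℕP.<⇒≤ (ℕP.≰⇒> ℓ≰))))) z≤)

    step-necessary : ∀ {a′ h C} (a′<h : a′ < h) (h<end : suc h ≤ suc (a′ + m)) (S : Sweep a′ h C) →
                     SweepNecessary (SweepStep.sweep a′<h h<end S) → SweepNecessary S
    step-necessary {a′} {h} {C} a′<h h<end S nec γ z Cγ =
      by-role (γ F.≟ Sweep.carried S) (γ F.≟ Sweep.inner S (suc h))
      where
        open SweepStep a′<h h<end S
        open Sweep S using (carried; inner; inner-site; carried-site)

        toppled : (γ ≡ carried ⊎ γ ≡ inner (suc h)) → ChipNecessary a′ h (toℕ γ) z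
        toppled γ∈ = subst (ChipNecessary a′ h (toℕ γ)) (sym z≡) (record
          { left = λ h<a′ → impossible (ℕP.≤-trans a′<h (ℕP.n≤1+n h)) h<a′
          ; passed = λ _ h<h → impossible (ℕP.≤-trans (ℕP.n<1+n h) (ℕP.n≤1+n _)) h<h
          ; ahead = λ _ _ →
              ℕP.≤-trans (s≤s (ChipNecessary.passed (nec small h D-small) a′<h (ℕP.n<1+n h)))
                (ℕP.≤-trans (ℕP.≤-reflexive (sym (ℕP.+-suc (toℕ small) a′)))
                            (ℕP.+-monoˡ-≤ (suc a′) (small-≤ γ∈)))
          ; settled = λ h≥ → impossible (ℕP.≤-trans (s≤s h<end) (ℕP.n≤1+n _)) h≥
          ; unsettled = λ _ → unsettled (in-pair γ∈) })
          where
            site-of : (γ ≡ carried ⊎ γ ≡ inner (suc h)) → z ≡ suc h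
            site-of (inj₁ γ≡) = site-injective {C = C} γ≡ Cγ carried-site
            site-of (inj₂ γ≡) = site-injective {C = C} γ≡ Cγ (inner-site (suc h) (s≤s z≤n) h<end (λ ()))
            z≡ = site-of γ∈
            unsettled : (γ ≡ small ⊎ γ ≡ large) → toℕ γ ≤ suc (a′ + m)
            unsettled (inj₁ refl) =
              ChipNecessary.unsettled (nec small h D-small) (ℕP.≤-trans (ℕP.n≤1+n h) (ℕP.≤-trans h<end (ℕP.n≤1+n _)))
            unsettled (inj₂ refl) = ChipNecessary.unsettled (nec large (suc (suc h)) D-large) (s≤s h<end)

        by-role : Dec (γ ≡ carried) → Dec (γ ≡ inner (suc h)) → ChipNecessary a′ h (toℕ γ) z
        by-role (yes γ≡) _ = toppled (inj₁ γ≡)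
        by-role (no _) (yes γ≡) = toppled (inj₂ γ≡)
        by-role (no γ≢carried) (no γ≢inner) = record
          { left = left
          ; passed = λ z> z<h → passed z> (ℕP.≤-trans z<h (ℕP.n≤1+n _))
          ; ahead = λ z> z≤ → ahead (ℕP.≤∧≢⇒< z> (λ e → z≢suc-h (sym e))) z≤
          ; settled = settled
          ; unsettled = unsettled }
          where
            open ChipNecessary (nec γ z (trans (D-other γ≢carried γ≢inner) Cγ))
            z≢suc-h = proj₂ (off-the-step S a′<h h<end Cγ γ≢carried γ≢inner)

    start-bounds : ∀ {a′ C} (S : Shape (suc a′) C) → SweepNecessary (SweepStart.sweep S) →
                   LabelBounds (suc a′) C
    start-bounds {a′} {C} S nec γ z Cγ = by-role (γ F.≟ Shape.extra S) (γ F.≟ Shape.inner S (suc a′))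
      where
        open SweepStart S
        open Shape S using (extra; inner; inner-site; extra-site)

        toppled : (γ ≡ extra ⊎ γ ≡ inner (suc a′)) → LabelBound (suc a′) (toℕ γ) z
        toppled γ∈ = subst (LabelBound (suc a′) (toℕ γ)) (sym z≡) (label-bound
          (λ a′≥ → impossible (s≤s (s≤s (ℕP.≤-trans (ℕP.m≤m+n a′ m) (ℕP.n≤1+n _)))) a′≥)
          (λ _ → ℕP.m≤n+m (suc a′) (toℕ γ) , unsettled (in-pair γ∈)))
          where
            site-of : (γ ≡ extra ⊎ γ ≡ inner (suc a′)) → z ≡ suc a′
            site-of (inj₁ γ≡) = site-injective {C = C} γ≡ Cγ extra-site
            site-of (inj₂ γ≡) = site-injective {C = C} γ≡ Cγ (inner-site (suc a′) (s≤s z≤n) (s≤s (ℕP.m≤m+n a′ m)))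
            z≡ = site-of γ∈
            unsettled : (γ ≡ small ⊎ γ ≡ large) → toℕ γ ≤ suc a′ + m
            unsettled (inj₁ refl) =
              ChipNecessary.unsettled (nec small a′ D-small)
                (ℕP.≤-trans (ℕP.m≤m+n a′ m) (ℕP.≤-trans (ℕP.n≤1+n _) (ℕP.n≤1+n _)))
            unsettled (inj₂ refl) =
              ChipNecessary.unsettled (nec large (suc (suc a′)) D-large) (s≤s (s≤s (ℕP.m≤m+n a′ m)))

        by-role : Dec (γ ≡ extra) → Dec (γ ≡ inner (suc a′)) → LabelBound (suc a′) (toℕ γ) z
        by-role (yes γ≡) _ = toppled (inj₁ γ≡)
        by-role (no _) (yes γ≡) = toppled (inj₂ γ≡)
        by-role (no γ≢extra) (no γ≢inner) = label-bound settled windowed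
          where
            open ChipNecessary (nec γ z (trans (D-other γ≢extra γ≢inner) Cγ))
            z≢ = off-the-double S Cγ γ≢extra γ≢inner
            windowed : z ≤ suc a′ + m → z ≤ toℕ γ + suc a′ × toℕ γ ≤ z + m
            windowed z≤ with z ≤? a′
            ... | yes z≤a′ = ℕP.≤-trans z≤a′ (ℕP.≤-trans (ℕP.n≤1+n a′) (ℕP.m≤n+m (suc a′) (toℕ γ))) , left z≤a′
            ... | no z≰a′ =
              ahead (ℕP.≤∧≢⇒< (ℕP.≰⇒> z≰a′) (λ e → z≢ (sym e))) z≤ ,
              ℕP.≤-trans (unsettled (ℕP.≤-trans z≤ (ℕP.n≤1+n _))) (ℕP.+-monoˡ-≤ m (ℕP.≰⇒> z≰a′))

    sweep-run : ∀ d {a′ h C} → a′ < h → h + d ≡ suc (a′ + m) → (S : Sweep a′ h C) →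
                ∃ λ D → ∃ λ k → Steps k C D × Σ (Sweep a′ (suc (a′ + m)) D) λ S′ →
                  (SweepInvariant S → SweepInvariant S′) × (SweepNecessary S′ → SweepNecessary S)
    sweep-run zero {h = h} {C} a′<h h+0≡ S with trans (sym (ℕP.+-identityʳ h)) h+0≡
    ... | refl = C , 0 , done , S , (λ inv → inv) , (λ nec → nec)
    sweep-run (suc d) {a′} {h} a′<h h+d≡ S =
      let D , k , steps , S′ , forward , backward =
            sweep-run d (ℕP.≤-trans a′<h (ℕP.n≤1+n h)) (trans (sym (ℕP.+-suc h d)) h+d≡)
                      (SweepStep.sweep a′<h h<end S)
      in D , suc k , step (SweepStep.toppling a′<h h<end S) steps , S′ ,
         (λ inv → forward (step-invariant a′<h h<end S inv)) ,
         (λ nec → step-necessary a′<h h<end S (backward nec))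
      where
        h<end : suc h ≤ suc (a′ + m)
        h<end = ℕP.≤-trans (s≤s (ℕP.m≤m+n h d)) (ℕP.≤-reflexive (trans (sym (ℕP.+-suc h d)) h+d≡))

    pass : ∀ {a′ C} → suc (a′ + m) ≤ n → Shape (suc a′) C →
           ∃ λ D → ∃ λ k → Steps k C D × Shape a′ D × (LabelBounds (suc a′) C ⇔ LabelBounds a′ D)
    pass {a′} fits S =
      let D , k , steps , S′ , forward , backward = sweep-run m ℕP.≤-refl refl (SweepStart.sweep S)
      in D , suc k , step (SweepStart.toppling S) steps , SweepEnd.shape fits S′ ,
         mk⇔ (λ bounds → end-bounds fits S′ (forward (start-invariant S bounds)))
             (λ bounds → start-bounds S (backward (end-necessary fits S′ bounds)))

    run : ∀ a {C} → a + m ≤ n → Shape a C →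
          ∃ λ F → ∃ λ k → Steps k C F × Shape 0 F × (LabelBounds a C ⇔ LabelBounds 0 F)
    run zero {C} _ S = C , 0 , done , S , ⇔-id _
    run (suc a′) fits S =
      let D , k , steps , S′ , bounds⇔ = pass fits S
          F , k′ , steps′ , S″ , bounds⇔′ = run a′ (ℕP.≤-trans (ℕP.n≤1+n _) fits) S′
      in F , k + k′ , steps ++ˢ steps′ , S″ , bounds⇔′ ⇔-∘ bounds⇔

    SortedSite : ℕ → ℕ → Set
    SortedSite ℓ x = (ℓ ≤ m × x ≡ ℓ) ⊎ (m < ℓ × x ≡ suc ℓ)

    module Final {F : Config n} (S : Shape 0 F) (m≤n : m ≤ n) where
      open Shape S

      Occupied : ℕ → Set
      Occupied x = x ≤ m ⊎ (suc (suc m) ≤ x × x ≤ suc n)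

      placed : ∀ γ → ∃ λ x → F γ ≡ + x × Occupied x
      placed γ with cover γ
      ... | inj₁ γ≡extra = 0 , trans (cong F γ≡extra) extra-site , inj₁ z≤n
      ... | inj₂ (inj₁ (j , 1≤j , j≤m , γ≡)) = j , trans (cong F γ≡) (inner-site j 1≤j j≤m) , inj₁ j≤m
      ... | inj₂ (inj₂ (y , y≥ , y≤ , γ≡)) = y , trans (cong F γ≡) (outer-site y y≥ y≤) , inj₂ (y≥ , y≤)

      site : Chip n → ℕ
      site γ = proj₁ (placed γ)

      site-≡ : ∀ γ → F γ ≡ + site γ
      site-≡ γ = proj₁ (proj₂ (placed γ))

      site-occupied : ∀ γ → Occupied (site γ)
      site-occupied γ = proj₂ (proj₂ (placed γ))

      hole-unoccupied : ¬ Occupied (suc m)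
      hole-unoccupied (inj₁ m+1≤m) = ℕP.<-irrefl refl m+1≤m
      hole-unoccupied (inj₂ (m+2≤m+1 , _)) = ℕP.<-irrefl refl m+2≤m+1

      occupant : ℕ → Chip n
      occupant zero = extra
      occupant (suc j) with suc j ≤? m
      ... | yes _ = inner (suc j)
      ... | no _  = outer (suc j)

      occupant-unique : ∀ {γ x} → F γ ≡ + x → γ ≡ occupant x
      occupant-unique {γ} {x} Fγ with cover γ
      ... | inj₁ γ≡extra with site-injective {C = F} γ≡extra Fγ extra-site
      ...   | refl = γ≡extra
      occupant-unique {γ} {x} Fγ | inj₂ (inj₁ (suc j , 1≤j , j≤m , γ≡)) with site-injective {C = F} γ≡ Fγ (inner-site (suc j) 1≤j j≤m)
      ...   | refl with suc j ≤? m
      ...     | yes _ = γ≡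
      ...     | no j≰m = ⊥-elim (j≰m j≤m)
      occupant-unique {γ} {x} Fγ | inj₂ (inj₂ (suc y , y≥ , y≤ , γ≡)) with site-injective {C = F} γ≡ Fγ (outer-site (suc y) y≥ y≤)
      ...   | refl with suc y ≤? m
      ...     | yes y≤m = impossible (ℕP.≤-trans (s≤s y≤m) (ℕP.n≤1+n _)) y≥
      ...     | no _ = γ≡

      site-determines-chip : ∀ {γ δ} → F γ ≡ F δ → γ ≡ δ
      site-determines-chip {γ} {δ} Fγ≡Fδ =
        trans (occupant-unique (site-≡ γ)) (sym (occupant-unique (trans (sym Fγ≡Fδ) (site-≡ γ))))

      stable : Stable F
      stable α β α≢β Fα≡Fβ = α≢β (site-determines-chip Fα≡Fβ)

      -- Labels beyond n name chip 0; only labels ℓ ≤ n are ever used.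
      chip-labelled : ℕ → Chip n
      chip-labelled ℓ with ℓ ℕ.<? suc n
      ... | yes ℓ<  = F.fromℕ< ℓ<
      ... | no _    = F.zero

      label-of-chip-labelled : ∀ ℓ → ℓ ≤ n → toℕ (chip-labelled ℓ) ≡ ℓ
      label-of-chip-labelled ℓ ℓ≤n with ℓ ℕ.<? suc n
      ... | yes ℓ<  = FinP.toℕ-fromℕ< ℓ<
      ... | no ℓ≮  = ⊥-elim (ℓ≮ (s≤s ℓ≤n))

      chip-labelled-label : ∀ γ → chip-labelled (toℕ γ) ≡ γ
      chip-labelled-label γ = FinP.toℕ-injective (label-of-chip-labelled (toℕ γ) (ℕP.≤-pred (FinP.toℕ<n γ)))

      site-of-label : ℕ → ℕ
      site-of-label ℓ = site (chip-labelled ℓ)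

      site-of-label-injective : ∀ ℓ ℓ′ → ℓ ≤ n → ℓ′ ≤ n → site-of-label ℓ ≡ site-of-label ℓ′ → ℓ ≡ ℓ′
      site-of-label-injective ℓ ℓ′ ℓ≤n ℓ′≤n e =
        trans (sym (label-of-chip-labelled ℓ ℓ≤n))
              (trans (cong toℕ (site-determines-chip (trans (site-≡ _) (trans (cong +_ e) (sym (site-≡ _))))))
                     (label-of-chip-labelled ℓ′ ℓ′≤n))

      Sorted : Set
      Sorted = ∀ γ → SortedSite (toℕ γ) (site γ)

      sorted-by-labels : (∀ ℓ → ℓ ≤ m → site-of-label ℓ ≡ ℓ) →
                         (∀ ℓ → m < ℓ → ℓ ≤ n → site-of-label ℓ ≡ suc ℓ) → Sorted
      sorted-by-labels low high γ with toℕ γ ≤? m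
      ... | yes ℓ≤m = inj₁ (ℓ≤m , trans (cong site (sym (chip-labelled-label γ))) (low (toℕ γ) ℓ≤m))
      ... | no ℓ≰m = inj₂ (ℕP.≰⇒> ℓ≰m , trans (cong site (sym (chip-labelled-label γ)))
                                                (high (toℕ γ) (ℕP.≰⇒> ℓ≰m) (ℕP.≤-pred (FinP.toℕ<n γ))))

      InOrder⇒Sorted : InOrder F → Sorted
      InOrder⇒Sorted in-order = sorted-by-labels (λ ℓ ℓ≤m → below-hole ℓ ℓ≤m m≤n) above-hole
        where
          increasing : ∀ ℓ → suc ℓ ≤ n → site-of-label ℓ < site-of-label (suc ℓ)
          increasing ℓ ℓ<n = ℤP.drop‿+<+ (subst₂ ℤ._<_ (site-≡ _) (site-≡ _)
            (in-order (chip-labelled ℓ) (chip-labelled (suc ℓ))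
                      (subst₂ _<_ (sym (label-of-chip-labelled ℓ (ℕP.≤-trans (ℕP.n≤1+n ℓ) ℓ<n)))
                                  (sym (label-of-chip-labelled (suc ℓ) ℓ<n)) (ℕP.n<1+n ℓ))))
          bounded : ∀ ℓ → ℓ ≤ n → site-of-label ℓ ≤ suc n
          bounded ℓ _ with site-occupied (chip-labelled ℓ)
          ... | inj₁ x≤m = ℕP.≤-trans x≤m (ℕP.≤-trans m≤n (ℕP.n≤1+n n))
          ... | inj₂ (_ , x≤) = x≤
          open IncreasingAroundHole site-of-label increasing bounded
                 (λ ℓ _ e → hole-unoccupied (subst Occupied e (site-occupied (chip-labelled ℓ))))

      Sorted⇒InOrder : Sorted → InOrder F
      Sorted⇒InOrder sorted α β α<β =
        subst₂ ℤ._<_ (sym (site-≡ α)) (sym (site-≡ β)) (ℤ.+<+ (ordered (sorted α) (sorted β)))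
        where
          ordered : SortedSite (toℕ α) (site α) → SortedSite (toℕ β) (site β) → site α < site β
          ordered (inj₁ (_ , eα)) (inj₁ (_ , eβ)) = subst₂ _<_ (sym eα) (sym eβ) α<β
          ordered (inj₁ (_ , eα)) (inj₂ (_ , eβ)) = subst₂ _<_ (sym eα) (sym eβ) (ℕP.m≤n⇒m≤1+n α<β)
          ordered (inj₂ (m<α , _)) (inj₁ (β≤m , _)) = impossible (ℕP.<-trans m<α α<β) β≤m
          ordered (inj₂ (_ , eα)) (inj₂ (_ , eβ)) = subst₂ _<_ (sym eα) (sym eβ) (s≤s α<β)

      Sorted⇒LabelBounds : Sorted → LabelBounds 0 F
      Sorted⇒LabelBounds sorted γ x Fγ with subst (SortedSite (toℕ γ)) (site-injective {C = F} refl (site-≡ γ) Fγ) (sorted γ)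
      ... | inj₁ (ℓ≤m , refl) = label-bound (λ ℓ≥ → impossible (s≤s (ℕP.m≤n⇒m≤1+n ℓ≤m)) ℓ≥)
                                            (λ _ → ℕP.≤-reflexive (sym (ℕP.+-identityʳ x)) , ℕP.m≤m+n x m)
      ... | inj₂ (m<ℓ , refl) = label-bound (λ _ → refl) (λ ℓ+1≤m → impossible (ℕP.<-trans m<ℓ (ℕP.n<1+n _)) ℓ+1≤m)

      LabelBounds⇒Sorted : LabelBounds 0 F → Sorted
      LabelBounds⇒Sorted bounds = sorted-by-labels fixed high
        where
          not-up : ∀ ℓ → ℓ ≤ m → site-of-label ℓ ≤ ℓ
          not-up ℓ ℓ≤m with site-occupied (chip-labelled ℓ) | bounds (chip-labelled ℓ) _ (site-≡ (chip-labelled ℓ))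
          ... | inj₁ x≤m | label-bound _ windowed =
            ℕP.≤-trans (proj₁ (windowed x≤m))
                       (ℕP.≤-reflexive (trans (ℕP.+-identityʳ _) (label-of-chip-labelled ℓ (ℕP.≤-trans ℓ≤m m≤n))))
          ... | inj₂ (x≥ , _) | label-bound settled _ =
            impossible (s≤s ℓ≤m) (ℕP.≤-pred (ℕP.≤-trans x≥ (ℕP.≤-reflexive (sym (trans
              (cong suc (sym (label-of-chip-labelled ℓ (ℕP.≤-trans ℓ≤m m≤n)))) (settled x≥))))))
          open InjectiveBelow site-of-label m≤n site-of-label-injective not-up
          high : ∀ ℓ → m < ℓ → ℓ ≤ n → site-of-label ℓ ≡ suc ℓ
          high ℓ m<ℓ ℓ≤n =
            trans (settled-site S bounds (chip-labelled ℓ) _ (site-≡ _)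
                                (subst (m <_) (sym (label-of-chip-labelled ℓ ℓ≤n)) m<ℓ))
                  (cong suc (label-of-chip-labelled ℓ ℓ≤n))

      InOrder⇔LabelBounds : InOrder F ⇔ LabelBounds 0 F
      InOrder⇔LabelBounds = mk⇔ (λ in-order → Sorted⇒LabelBounds (InOrder⇒Sorted in-order))
                               (λ bounds → Sorted⇒InOrder (LabelBounds⇒Sorted bounds))

module Initial where

  open import Defs
  open Confluence
  open import Data.Nat using (ℕ; zero; suc; _≤_; z≤n; s≤s)
  import Data.Nat.Properties as ℕP
  open import Data.Integer as ℤ using (ℤ; +_)
  import Data.Integer.Properties as ℤP
  open import Data.Fin as F using (Fin)
  import Data.Fin.Properties as FinP
  open import Data.List using (List; []; _∷_; map; upTo; tabulate; filter; length)
  open import Data.List.Properties using (filter-accept; filter-reject; filter-none; map-tabulate)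
  import Data.List.Relation.Unary.All as All
  open import Data.List.Relation.Unary.Any using (here; there)
  open import Data.List.Relation.Unary.Unique.Propositional using (Unique; []; _∷_)
  import Data.List.Relation.Unary.Unique.Propositional.Properties as Unique
  open import Data.List.Membership.Propositional using (_∈_)
  open import Data.List.Membership.Propositional.Properties using (∈-map⁺; ∈-map⁻; ∈-tabulate⁺; ∈-upTo⁺; ∈-upTo⁻; ∈-allFin)
  open import Data.List.Relation.Binary.Permutation.Propositional using (_↭_; ↭-sym)
  open import Data.List.Relation.Binary.Permutation.Propositional.Properties using (↭-length; filter-↭; ∈-resp-↭)
  open import Data.Product using (∃; ∃₂; _×_; _,_)
  open import Data.Empty using (⊥; ⊥-elim)
  open import Relation.Nullary using (Dec; yes; no)
  open import Relation.Binary.PropositionalEquality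

  multiplicity : ℤ → List ℤ → ℕ
  multiplicity t xs = length (filter (ℤ._≟ t) xs)

  multiplicity-↭ : ∀ t {xs ys} → xs ↭ ys → multiplicity t xs ≡ multiplicity t ys
  multiplicity-↭ t xs↭ys = ↭-length (filter-↭ (ℤ._≟ t) xs↭ys)

  multiplicity-hit : ∀ {t x} xs → x ≡ t → multiplicity t (x ∷ xs) ≡ suc (multiplicity t xs)
  multiplicity-hit {t} xs x≡t = cong length (filter-accept (ℤ._≟ t) x≡t)

  multiplicity-miss : ∀ {t x} xs → x ≢ t → multiplicity t (x ∷ xs) ≡ multiplicity t xs
  multiplicity-miss {t} xs x≢t = cong length (filter-reject (ℤ._≟ t) x≢t)

  multiplicity-∷-≤ : ∀ {t} x xs → multiplicity t (x ∷ xs) ≤ suc (multiplicity t xs)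
  multiplicity-∷-≤ {t} x xs = by (x ℤ.≟ t)
    where
      by : Dec (x ≡ t) → multiplicity t (x ∷ xs) ≤ suc (multiplicity t xs)
      by (yes x≡t) = ℕP.≤-reflexive (multiplicity-hit xs x≡t)
      by (no x≢t)  = ℕP.≤-trans (ℕP.≤-reflexive (multiplicity-miss xs x≢t)) (ℕP.n≤1+n _)

  ≤-multiplicity-∷ : ∀ {t} x xs → multiplicity t xs ≤ multiplicity t (x ∷ xs)
  ≤-multiplicity-∷ {t} x xs = by (x ℤ.≟ t)
    where
      by : Dec (x ≡ t) → multiplicity t xs ≤ multiplicity t (x ∷ xs)
      by (yes x≡t) = ℕP.≤-trans (ℕP.n≤1+n _) (ℕP.≤-reflexive (sym (multiplicity-hit xs x≡t)))
      by (no x≢t)  = ℕP.≤-reflexive (sym (multiplicity-miss xs x≢t))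

  multiplicity-∈ : ∀ {t xs} → t ∈ xs → 1 ≤ multiplicity t xs
  multiplicity-∈ {xs = x ∷ xs} (here t≡x) = ℕP.≤-trans (s≤s z≤n) (ℕP.≤-reflexive (sym (multiplicity-hit xs (sym t≡x))))
  multiplicity-∈ {xs = x ∷ xs} (there t∈xs) = ℕP.≤-trans (multiplicity-∈ t∈xs) (≤-multiplicity-∷ x xs)

  multiplicity-unique : ∀ t {xs} → Unique xs → multiplicity t xs ≤ 1
  multiplicity-unique t [] = z≤n
  multiplicity-unique t {x ∷ xs} (x≢xs ∷ unique) = by (x ℤ.≟ t)
    where
      by : Dec (x ≡ t) → multiplicity t (x ∷ xs) ≤ 1
      by (no x≢t)  = ℕP.≤-trans (ℕP.≤-reflexive (multiplicity-miss xs x≢t)) (multiplicity-unique t unique)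
      by (yes refl) = ℕP.≤-reflexive (trans (multiplicity-hit xs refl)
                        (cong (λ ys → suc (length ys))
                              (filter-none (ℤ._≟ x) (All.map (λ x≢y y≡x → x≢y (sym y≡x)) x≢xs))))

  hit : ∀ {k} (f : Fin k → ℤ) {a t} → f a ≡ t → 1 ≤ multiplicity t (tabulate f)
  hit f {a} fa≡t = multiplicity-∈ (subst (_∈ tabulate f) fa≡t (∈-tabulate⁺ a))

  two-hits : ∀ {k} (f : Fin k → ℤ) {a b t} → a ≢ b → f a ≡ t → f b ≡ t → 2 ≤ multiplicity t (tabulate f)
  two-hits f {F.zero} {F.zero} a≢b _ _ = ⊥-elim (a≢b refl)
  two-hits f {F.zero} {F.suc b} _ fa fb =
    ℕP.≤-trans (s≤s (hit (λ i → f (F.suc i)) fb)) (ℕP.≤-reflexive (sym (multiplicity-hit _ fa)))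
  two-hits f {F.suc a} {F.zero} _ fa fb =
    ℕP.≤-trans (s≤s (hit (λ i → f (F.suc i)) fa)) (ℕP.≤-reflexive (sym (multiplicity-hit _ fb)))
  two-hits f {F.suc a} {F.suc b} a≢b fa fb =
    ℕP.≤-trans (two-hits (λ i → f (F.suc i)) (λ e → a≢b (cong F.suc e)) fa fb) (≤-multiplicity-∷ (f F.zero) (tabulate (λ i → f (F.suc i))))

  three-hits : ∀ {k} (f : Fin k → ℤ) {a b c t} → a ≢ b → b ≢ c → a ≢ c →
               f a ≡ t → f b ≡ t → f c ≡ t → 3 ≤ multiplicity t (tabulate f)
  three-hits f {F.zero} {F.zero} a≢b _ _ _ _ _ = ⊥-elim (a≢b refl)
  three-hits f {F.suc _} {F.zero} {F.zero} _ b≢c _ _ _ _ = ⊥-elim (b≢c refl)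
  three-hits f {F.zero} {F.suc _} {F.zero} _ _ a≢c _ _ _ = ⊥-elim (a≢c refl)
  three-hits f {F.zero} {F.suc b} {F.suc c} _ b≢c _ fa fb fc =
    ℕP.≤-trans (s≤s (two-hits (λ i → f (F.suc i)) (λ e → b≢c (cong F.suc e)) fb fc))
               (ℕP.≤-reflexive (sym (multiplicity-hit _ fa)))
  three-hits f {F.suc a} {F.zero} {F.suc c} _ _ a≢c fa fb fc =
    ℕP.≤-trans (s≤s (two-hits (λ i → f (F.suc i)) (λ e → a≢c (cong F.suc e)) fa fc))
               (ℕP.≤-reflexive (sym (multiplicity-hit _ fb)))
  three-hits f {F.suc a} {F.suc b} {F.zero} a≢b _ _ fa fb fc =
    ℕP.≤-trans (s≤s (two-hits (λ i → f (F.suc i)) (λ e → a≢b (cong F.suc e)) fa fb))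
               (ℕP.≤-reflexive (sym (multiplicity-hit _ fc)))
  three-hits f {F.suc a} {F.suc b} {F.suc c} a≢b b≢c a≢c fa fb fc =
    ℕP.≤-trans (three-hits (λ i → f (F.suc i)) (λ e → a≢b (cong F.suc e)) (λ e → b≢c (cong F.suc e))
                                                (λ e → a≢c (cong F.suc e)) fa fb fc)
               (≤-multiplicity-∷ (f F.zero) (tabulate (λ i → f (F.suc i))))

  pick-one : ∀ {k} (f : Fin k → ℤ) {t} → 1 ≤ multiplicity t (tabulate f) → ∃ λ a → f a ≡ t
  pick-one {zero} f ()
  pick-one {suc k} f {t} positive with f F.zero ℤ.≟ t
  ... | yes f0≡t = F.zero , f0≡t
  ... | no _ = let a , fa≡t = pick-one (λ i → f (F.suc i)) positive in F.suc a , fa≡t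

  pick-two : ∀ {k} (f : Fin k → ℤ) {t} → 2 ≤ multiplicity t (tabulate f) →
             ∃₂ λ a b → a ≢ b × f a ≡ t × f b ≡ t
  pick-two {zero} f ()
  pick-two {suc k} f {t} two with f F.zero ℤ.≟ t
  ... | yes f0≡t = let b , fb≡t = pick-one (λ i → f (F.suc i)) (ℕP.≤-pred two)
                   in F.zero , F.suc b , (λ ()) , f0≡t , fb≡t
  ... | no _ = let a , b , a≢b , fa≡t , fb≡t = pick-two (λ i → f (F.suc i)) two
               in F.suc a , F.suc b , (λ e → a≢b (FinP.suc-injective e)) , fa≡t , fb≡t

  targets : ℕ → List ℤ
  targets n = map (λ k → + suc k) (upTo n)

  targets-unique : ∀ n → Unique (targets n)
  targets-unique n = Unique.map⁺ (λ e → ℕP.suc-injective (ℤP.+-injective e)) (Unique.upTo⁺ n)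

  ∈-targets⁺ : ∀ {n j} → 1 ≤ j → j ≤ n → + j ∈ targets n
  ∈-targets⁺ {j = suc k} _ j≤n = ∈-map⁺ (λ k → + suc k) (∈-upTo⁺ j≤n)

  ∈-targets⁻ : ∀ {n y} → y ∈ targets n → ∃ λ j → y ≡ + j × 1 ≤ j × j ≤ n
  ∈-targets⁻ y∈ = let k , k∈ , y≡ = ∈-map⁻ (λ k → + suc k) y∈ in suc k , y≡ , s≤s z≤n , ∈-upTo⁻ k∈

  module InitialConfiguration {n p : ℕ} (1≤p : 1 ≤ p) (p≤n : p ≤ n) {C : Config n} (ins : InS n p C) where

    site-range : ∀ γ → ∃ λ x → C γ ≡ + x × 1 ≤ x × x ≤ n
    site-range γ with ∈-resp-↭ ins (∈-map⁺ C (∈-allFin γ))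
    ... | here Cγ≡p = p , Cγ≡p , 1≤p , p≤n
    ... | there Cγ∈ = ∈-targets⁻ Cγ∈

    occupied : ∀ j → 1 ≤ j → j ≤ n → ∃ λ γ → C γ ≡ + j
    occupied j 1≤j j≤n =
      let γ , _ , j≡ = ∈-map⁻ C (∈-resp-↭ (↭-sym ins) (there (∈-targets⁺ 1≤j j≤n))) in γ , sym j≡

    multiplicity-C : ∀ t → multiplicity t (tabulate C) ≡ multiplicity t (+ p ∷ targets n)
    multiplicity-C t = trans (cong (multiplicity t) (sym (map-tabulate (λ i → i) C))) (multiplicity-↭ t ins)

    extra-pair : ∃₂ λ a b → a ≢ b × C a ≡ + p × C b ≡ + p
    extra-pair = pick-two C (ℕP.≤-trans (s≤s (multiplicity-∈ (∈-targets⁺ 1≤p p≤n)))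
                                        (ℕP.≤-reflexive (sym (trans (multiplicity-C (+ p)) (multiplicity-hit {t = + p} (targets n) refl)))))

    shared-site-is-p : ∀ {a b t} → a ≢ b → C a ≡ t → C b ≡ t → t ≡ + p
    shared-site-is-p {t = t} a≢b Ca Cb with + p ℤ.≟ t
    ... | yes p≡t = sym p≡t
    ... | no p≢t = ⊥-elim (ℕP.<⇒≱ (two-hits C a≢b Ca Cb) (begin
      multiplicity t (tabulate C)        ≡⟨ multiplicity-C t ⟩
      multiplicity t (+ p ∷ targets n)   ≡⟨ multiplicity-miss (targets n) p≢t ⟩
      multiplicity t (targets n)         ≤⟨ multiplicity-unique t (targets-unique n) ⟩
      1                                  ∎))
      where open ℕP.≤-Reasoning

    at-most-two : ∀ {a b c t} → a ≢ b → b ≢ c → a ≢ c → C a ≡ t → C b ≡ t → C c ≡ t → ⊥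
    at-most-two {t = t} a≢b b≢c a≢c Ca Cb Cc = ℕP.<⇒≱ (three-hits C a≢b b≢c a≢c Ca Cb Cc) (begin
      multiplicity t (tabulate C)        ≡⟨ multiplicity-C t ⟩
      multiplicity t (+ p ∷ targets n)   ≤⟨ multiplicity-∷-≤ (+ p) (targets n) ⟩
      suc (multiplicity t (targets n))   ≤⟨ s≤s (multiplicity-unique t (targets-unique n)) ⟩
      2                                  ∎)
      where open ℕP.≤-Reasoning

    tame : Tame C
    tame = record
      { at-most-two = at-most-two
      ; vacancy-between = λ (a , b , a≢b , Ca , Cb) (c , d , c≢d , Cc , Cd) t<u →
          ⊥-elim (ℤP.<-irrefl (trans (shared-site-is-p a≢b Ca Cb) (sym (shared-site-is-p c≢d Cc Cd))) t<u) }

module Characterisation where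

  open import Defs
  open Confluence
  open Run
  open Initial
  open import Data.Nat as ℕ using (ℕ; suc; _+_; _∸_; _≤_; s≤s; _≤?_)
  import Data.Nat.Properties as ℕP
  open import Data.Integer as ℤ using (+_; _⊖_)
  import Data.Integer.Properties as ℤP
  open import Data.Fin as F using (toℕ)
  open import Data.Product using (_×_; _,_; proj₁; proj₂)
  open import Data.Sum using (inj₁; inj₂)
  open import Data.Empty using (⊥-elim)
  open import Relation.Nullary using (Dec; yes; no)
  open import Relation.Binary.PropositionalEquality
  open import Function.Bundles using (_⇔_; mk⇔; Equivalence)

  ⊖≤+⇔ : ∀ a b c → (a ⊖ b ℤ.≤ + c) ⇔ (a ≤ b + c)
  ⊖≤+⇔ a b c with b ≤? a
  ... | yes b≤a = mk⇔
    (λ le → ℕP.≤-trans (ℕP.m≤n+m∸n a b) (ℕP.+-monoʳ-≤ b (ℤP.drop‿+≤+ (subst (ℤ._≤ + c) (ℤP.⊖-≥ b≤a) le))))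
    (λ le → subst (ℤ._≤ + c) (sym (ℤP.⊖-≥ b≤a)) (ℤ.+≤+ (ℕP.m≤n+o⇒m∸n≤o a b le)))
  ... | no b≰a = mk⇔
    (λ _ → ℕP.≤-trans (ℕP.<⇒≤ (ℕP.≰⇒> b≰a)) (ℕP.m≤m+n b c))
    (λ _ → subst (ℤ._≤ + c) (sym (ℤP.⊖-< (ℕP.≰⇒> b≰a))) ℤP.neg-≤-pos)

  module Toppleability {n p : ℕ} (1≤p : 1 ≤ p) (p≤n : p ≤ n) {C : Config n} (ins : InS n p C) where
    open InitialConfiguration 1≤p p≤n ins

    m : ℕ
    m = n ∸ p

    p+m≡n : p + m ≡ n
    p+m≡n = ℕP.m+[n∸m]≡n p≤n

    open Passes {n} m

    private
      first second : Chip n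
      first = proj₁ extra-pair
      second = proj₁ (proj₂ extra-pair)
      first≢second : first ≢ second
      first≢second = proj₁ (proj₂ (proj₂ extra-pair))
      first-site : C first ≡ + p
      first-site = proj₁ (proj₂ (proj₂ (proj₂ extra-pair)))
      second-site : C second ≡ + p
      second-site = proj₂ (proj₂ (proj₂ (proj₂ extra-pair)))

      -- Off [1, n] the choice is irrelevant.
      pick : (j : ℕ) → Dec (j ≡ p) → Dec (1 ≤ j) → Dec (j ≤ n) → Chip n
      pick j (yes _) _ _ = second
      pick j (no _) (yes 1≤j) (yes j≤n) = proj₁ (occupied j 1≤j j≤n)
      pick j (no _) _ _ = first

      pick-site : ∀ j → 1 ≤ j → j ≤ n → ∀ d₁ d₂ d₃ → C (pick j d₁ d₂ d₃) ≡ + j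
      pick-site j _ _ (yes refl) _ _ = second-site
      pick-site j _ _ (no _) (yes 1≤j) (yes j≤n) = proj₂ (occupied j 1≤j j≤n)
      pick-site j 1≤j _ (no _) (no 1≰j) _ = ⊥-elim (1≰j 1≤j)
      pick-site j _ j≤n (no _) (yes _) (no j≰n) = ⊥-elim (j≰n j≤n)

      pick-p : ∀ d₁ d₂ d₃ → pick p d₁ d₂ d₃ ≡ second
      pick-p (yes _) _ _ = refl
      pick-p (no p≢p) _ _ = ⊥-elim (p≢p refl)

      inner : ℕ → Chip n
      inner j = pick j (j ℕ.≟ p) (1 ≤? j) (j ≤? n)

      inner-site : ∀ j → 1 ≤ j → j ≤ n → C (inner j) ≡ + j
      inner-site j 1≤j j≤n = pick-site j 1≤j j≤n (j ℕ.≟ p) (1 ≤? j) (j ≤? n)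

      inner-p : inner p ≡ second
      inner-p = pick-p (p ℕ.≟ p) (1 ≤? p) (p ≤? n)

    shape : Shape p C
    shape = record
      { extra = first ; inner = inner ; outer = λ _ → first
      ; extra-site = first-site
      ; inner-site = λ j 1≤j j≤ → inner-site j 1≤j (subst (j ≤_) p+m≡n j≤)
      ; outer-site = λ y y≥ y≤ → impossible (ℕP.≤-reflexive (cong (λ k → suc (suc k)) (sym p+m≡n)))
                                             (ℕP.≤-trans y≥ y≤)
      ; extra≢inner = λ _ e → first≢second (trans e inner-p)
      ; cover = cover }
      where
        cover : ∀ γ → _
        cover γ with site-range γ
        ... | x , Cγ , 1≤x , x≤n with γ F.≟ first | γ F.≟ inner x
        ...   | yes γ≡first | _ = inj₁ γ≡first
        ...   | no _ | yes γ≡inner = inj₂ (inj₁ (x , 1≤x , subst (x ≤_) (sym p+m≡n) x≤n , γ≡inner))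
        ...   | no γ≢first | no γ≢inner =
          ⊥-elim (at-most-two γ≢first first≢second γ≢second Cγp first-site second-site)
          where
            x≡p : x ≡ p
            x≡p = ℤP.+-injective (shared-site-is-p γ≢inner Cγ (inner-site x 1≤x x≤n))
            Cγp = trans Cγ (cong +_ x≡p)
            γ≢second : γ ≢ second
            γ≢second e = γ≢inner (trans e (sym (subst (λ j → inner j ≡ second) (sym x≡p) inner-p)))

    lower-bound⇔ : ∀ ℓ x → (+ p ℤ.+ + suc ℓ ℤ.- + n ℤ.- + 1 ℤ.≤ + x) ⇔ (ℓ ≤ x + m)
    lower-bound⇔ ℓ x = mk⇔
      (λ le → ℕP.+-cancelˡ-≤ p ℓ (x + m) (ℕP.≤-pred (subst₂ _≤_ left right (to (subst (ℤ._≤ + x) lower≡ le)))))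
      (λ le → subst (ℤ._≤ + x) (sym lower≡) (from (subst₂ _≤_ (sym left) (sym right) (s≤s (ℕP.+-monoʳ-≤ p le)))))
      where
        open Equivalence (⊖≤+⇔ (p + suc ℓ) (suc (n + 0)) x)
        lower≡ : + p ℤ.+ + suc ℓ ℤ.- + n ℤ.- + 1 ≡ (p + suc ℓ) ⊖ suc (n + 0)
        lower≡ = trans (cong (ℤ._- + 1) (ℤP.[+m]-[+n]≡m⊖n (p + suc ℓ) n)) (ℤP.distribˡ-⊖-+-neg 0 (p + suc ℓ) n)
        left : p + suc ℓ ≡ suc (p + ℓ)
        left = ℕP.+-suc p ℓ
        right : suc (n + 0) + x ≡ suc (p + (x + m))
        right = cong suc (trans (cong (_+ x) (trans (ℕP.+-identityʳ n) (sym p+m≡n)))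
                                (trans (ℕP.+-assoc p m x) (cong (λ k → p + k) (ℕP.+-comm m x))))

    upper-bound⇔ : ∀ ℓ x → (+ x ℤ.≤ + p ℤ.+ + suc ℓ ℤ.- + 1) ⇔ (x ≤ ℓ + p)
    upper-bound⇔ ℓ x = mk⇔
      (λ le → subst (x ≤_) (ℕP.+-comm p ℓ) (ℤP.drop‿+≤+ (subst (+ x ℤ.≤_) upper≡ le)))
      (λ le → subst (+ x ℤ.≤_) (sym upper≡) (ℤ.+≤+ (subst (x ≤_) (ℕP.+-comm ℓ p) le)))
      where
        upper≡ : + p ℤ.+ + suc ℓ ℤ.- + 1 ≡ + (p + ℓ)
        upper≡ = cong (λ k → + k ℤ.- + 1) (ℕP.+-suc p ℓ)

    Condition : Set
    Condition = ∀ c → (+ p ℤ.+ + suc (toℕ c) ℤ.- + n ℤ.- + 1 ℤ.≤ C c) × (C c ℤ.≤ + p ℤ.+ + suc (toℕ c) ℤ.- + 1)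

    condition⇔bounds : Condition ⇔ LabelBounds p C
    condition⇔bounds = mk⇔ to from
      where
        to : Condition → LabelBounds p C
        to condition γ x Cγ = label-bound settled windowed
          where
            settled : suc (suc (p + m)) ≤ x → suc (toℕ γ) ≡ x
            settled x≥ =
              let x′ , Cγ′ , _ , x′≤n = site-range γ
                  x≤n = subst (_≤ n) (ℤP.+-injective (trans (sym Cγ′) Cγ)) x′≤n
              in impossible (s≤s (ℕP.≤-trans x≤n (ℕP.≤-trans (ℕP.≤-reflexive (sym p+m≡n)) (ℕP.n≤1+n _)))) x≥
            windowed : x ≤ p + m → x ≤ toℕ γ + p × toℕ γ ≤ x + m
            windowed _ = Equivalence.to (upper-bound⇔ (toℕ γ) x) (subst (ℤ._≤ _) Cγ (proj₂ (condition γ))) ,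
                         Equivalence.to (lower-bound⇔ (toℕ γ) x) (subst (_ ℤ.≤_) Cγ (proj₁ (condition γ)))
        from : LabelBounds p C → Condition
        from bounds c =
          let x , Cc , _ , x≤n = site-range c
              x≤ , ≤x = LabelBound.windowed (bounds c x Cc) (subst (x ≤_) (sym p+m≡n) x≤n)
          in subst (_ ℤ.≤_) (sym Cc) (Equivalence.from (lower-bound⇔ (toℕ c) x) ≤x) ,
             subst (ℤ._≤ _) (sym Cc) (Equivalence.from (upper-bound⇔ (toℕ c) x) x≤)

    toppleable⇔bounds : Toppleable C ⇔ LabelBounds p C
    toppleable⇔bounds with run p (ℕP.≤-reflexive p+m≡n) shape
    ... | F , _ , toF , final-shape , bounds⇔ = mk⇔
      (λ (G , toG , stableG , in-orderG) →
         Equivalence.from bounds⇔ (Equivalence.to InOrder⇔LabelBounds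
           (InOrder-resp (stable-result-unique tame toF stable toG stableG) in-orderG)))
      (λ bounds → F , Steps⇒Star toF , stable ,
                  Equivalence.from InOrder⇔LabelBounds (Equivalence.to bounds⇔ bounds))
      where open Final final-shape (ℕP.m∸n≤m n p)

open import Defs
open Characterisation using (module Toppleability)
open import Data.Nat using (ℕ; suc) renaming (_≤_ to _≤ℕ_)
open import Data.Integer using (_+_; _-_; _≤_; +_)
open import Data.Fin using (toℕ)
open import Data.Product using (_×_)
open import Function.Bundles using (_⇔_)
open import Function.Construct.Composition using (_⇔-∘_)
open import Function.Construct.Symmetry using (⇔-sym)

theorem4p2 : (n p : ℕ) → 1 ≤ℕ n → 1 ≤ℕ p → p ≤ℕ n →
    (C : Config n) → InS n p C →
    Toppleable C ⇔
    (∀ c → (+ p + + suc (toℕ c) - + n - + 1 ≤ C c) × (C c ≤ + p + + suc (toℕ c) - + 1))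
-- The hypothesis 1 ≤ n is implied by 1 ≤ p ≤ n.
theorem4p2 _ _ _ 1≤p p≤n _ ins = ⇔-sym condition⇔bounds ⇔-∘ toppleable⇔bounds
  where open Toppleability 1≤p p≤n ins
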